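{- For every $n \in \mathbb{N}$ let $Y_n : NC^{\mathrm{(mton)}}(n) \to \mathbb{N}$ be the random variable $Y_n(\pi,u) := |\pi|$ (the number of blocks of $\pi$), where $NC^{\mathrm{(mton)}}(n)$ carries the uniform probability distribution. Then: (1) $E[Y_n] = n - H_n + \frac{3}{2} - \frac{1}{n+1}$ for all $n \geq 2$; consequently $E[Y_n] \approx (n - \ln n) + \bigl(\frac{3}{2} - \gamma\bigr)$ as $n \to \infty$. (2) $\mathrm{Var}[Y_n] = H_n - H_n^{(2)} - \frac{(n-1)^2}{4(n+1)^2}$ for all $n \geq 2$; consequently $\mathrm{Var}[Y_n] \approx \ln n - \bigl(\frac{\pi^2}{6} + \frac{1}{4} - \gamma\bigr)$ as $n \to \infty$.
   Context: $NC(n)$ is the set of non-crossing partitions of $\{1,\ldots,n\}$. For $\pi \in NC(n)$ and blocks $V,W \in \pi$, "$V$ is nested inside $W$" means $\min V > \min W$ and $\max V < \max W$. A monotonic ordering of $\pi$ is a bijection $u : \pi \to \{1,\ldots,|\pi|\}$ such that $u(V) > u(W)$ whenever $V$ is nested inside $W$. $NC^{\mathrm{(mton)}}(n)$ is the set of pairs $(\pi,u)$ with $\pi \in NC(n)$ and $u$ a monotonic ordering of $\pi$. $H_n = \sum_{k=1}^n 1/k$, $H_n^{(2)} = \sum_{k=1}^n 1/k^2$, $\gamma$ is the Euler–Mascheroni constant, and $a_n \approx b_n$ means $a_n - b_n \to 0$ as $n \to \infty$. -}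

module Defs where

open import Data.Nat as ℕ using (ℕ; zero; suc)
open import Data.Fin as Fin using (Fin; toℕ)
open import Data.Vec using (Vec; lookup)
open import Data.List using (List; []; _∷_; filter; length; map; sum; allFin)
open import Data.Product using (_×_; Σ; ∃; _,_; proj₁; proj₂)
open import Data.Integer using (+_)
open import Data.Rational as ℚ using (ℚ; 0ℚ; 1ℚ)
open import Relation.Binary.PropositionalEquality using (_≡_; _≢_)
open import Relation.Nullary using (¬_)

-- Set partitions of {1,…,n} (here the positions 0,…,n-1 of Fin n).
-- A partition π is encoded canonically by b : Vec (Fin n) n, where
-- lookup b i is the least element of the block containing i.
-- The blocks of π are {j | b j ≡ b i}; blocks correspond bijectively
-- to the "minima" i with b i ≡ i.

module _ {n : ℕ} (b : Vec (Fin n) n) where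

  Same : Fin n → Fin n → Set
  Same i j = lookup b i ≡ lookup b j

  IsPartition : Set
  IsPartition = (∀ i → lookup b i Fin.≤ i)
              × (∀ i → lookup b (lookup b i) ≡ lookup b i)

  IsBlockMin : Fin n → Set
  IsBlockMin i = lookup b i ≡ i

  NonCrossing : Set
  NonCrossing = ∀ a p c d → a Fin.< p → p Fin.< c → c Fin.< d →
                Same a c → Same p d → Same a p

  -- The block with minimum v is nested inside the block with minimum w:
  -- min V > min W and max V < max W.
  NestedIn : Fin n → Fin n → Set
  NestedIn v w = (w Fin.< v)
               × ∃ (λ k → Same k w × (∀ j → Same j v → j Fin.< k))

  nBlocks : ℕ
  nBlocks = length (filter (λ i → lookup b i Fin.≟ i) (allFin n))

IsNC : (n : ℕ) → Vec (Fin n) n → Set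
IsNC n b = IsPartition b × NonCrossing b

-- A monotonic ordering u : π → {1,…,|π|}, encoded as u : Vec ℕ n where
-- lookup u i is the label of the block containing i.
IsMonotonicOrdering : {n : ℕ} → Vec (Fin n) n → Vec ℕ n → Set
IsMonotonicOrdering {n} b u =
    (∀ i → lookup u i ≡ lookup u (lookup b i))
  × (∀ i → 1 ℕ.≤ lookup u i × lookup u i ℕ.≤ nBlocks b)
    -- injective on blocks (hence a bijection onto {1,…,|π|})
  × (∀ v w → IsBlockMin b v → IsBlockMin b w → lookup u v ≡ lookup u w → v ≡ w)
  × (∀ v w → IsBlockMin b v → IsBlockMin b w → NestedIn b v w →
       lookup u w ℕ.< lookup u v)

NCMton : (n : ℕ) → Set
NCMton n = Vec (Fin n) n × Vec ℕ n

IsNCMton : (n : ℕ) → NCMton n → Set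
IsNCMton n (b , u) = IsNC n b × IsMonotonicOrdering b u

-- 1/k as a rational (with the convention 1/0 = 0, never used below)
inv : ℕ → ℚ
inv zero    = 0ℚ
inv (suc k) = + 1 ℚ./ suc k

fromℕ : ℕ → ℚ
fromℕ k = + k ℚ./ 1

sumℚ : List ℚ → ℚ
sumℚ []       = 0ℚ
sumℚ (x ∷ xs) = x ℚ.+ sumℚ xs

H : ℕ → ℚ
H zero    = 0ℚ
H (suc k) = H k ℚ.+ inv (suc k)

H2 : ℕ → ℚ
H2 zero    = 0ℚ
H2 (suc k) = H2 k ℚ.+ inv (suc k ℕ.* suc k)

-- Uniform distribution on a finite set given as a duplicate-free list:
-- expectation of a random variable f
E : {A : Set} → List A → (A → ℚ) → ℚ
E xs f = sumℚ (map f xs) ℚ.* inv (length xs)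

Var : {A : Set} → List A → (A → ℚ) → ℚ
Var xs f = E xs (λ x → f x ℚ.* f x) ℚ.- (E xs f ℚ.* E xs f)

Y : {n : ℕ} → NCMton n → ℚ
Y (b , u) = fromℕ (nBlocks b)

-- For (π, u) ∈ NC^(mton)(n + 1) let c be the last point of the block with the top label |π|. No block
-- is nested inside that block, so it is an interval of consecutive points: either c is a singleton, or
-- c − 1 lies in the same block. Removing c therefore exhibits each element of NC^(mton)(n + 1) as a
-- child of exactly one (σ, v) ∈ NC^(mton)(n): one of the n + 1 children obtained by inserting a new
-- singleton block with label |σ| + 1, or the single child obtained by appending a point to the block
-- labelled |σ|. Hence the sums S_g(n) = Σ g(|σ|) over NC^(mton)(n) satisfy
-- S_g(n + 1) = S_g(n) + (n + 1) S_{g(· + 1)}(n), and for g = 1, |σ|, |σ|² this yields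
-- E[Y_{n+1}] = E[Y_n] + (n+1)/(n+2) and Var[Y_{n+1}] = Var[Y_n] + (n+1)/(n+2)², which the closed
-- forms satisfy, starting from E[Y_1] = 1 and Var[Y_1] = 0.
module Submission where

open import Defs
open import Data.Nat as ℕ using (ℕ; zero; suc; z≤n; s≤s; _≤_; _∸_)
import Data.Nat.Properties as ℕ
open import Data.Nat.ListAction using (sum)
open import Data.Nat.ListAction.Properties using (sum-++)
import Data.Nat.Tactic.RingSolver as ℕ
open import Data.Integer as ℤ using (ℤ; +_)
import Data.Integer.Tactic.RingSolver as ℤ
open import Data.Rational as ℚ using (ℚ; 0ℚ; 1ℚ; _+_; _*_; _-_; _/_)
import Data.Rational.Properties as ℚ
open import Data.Rational.Unnormalised as ℚᵘ using (mkℚᵘ; *≡*)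
import Data.Rational.Unnormalised.Properties as ℚᵘ
open import Data.Fin as Fin using (Fin; toℕ; punchIn; punchOut)
open import Data.Fin.Properties as Fin using (punchIn-injective; punchInᵢ≢i; punchIn-punchOut; toℕ-injective)
open import Data.Vec as Vec using (Vec; lookup; insertAt)
open import Data.Vec.Properties using (insertAt-lookup; insertAt-punchIn; lookup-map; lookup∘tabulate; tabulate∘lookup; tabulate-cong)
open import Data.List as List using (List; []; _∷_; _++_; filter; length; map; concatMap; allFin)
import Data.List.Properties as List
open import Data.List.Relation.Unary.All as All using (All)
open import Data.List.Relation.Unary.All.Properties as All using ()
open import Data.List.Relation.Unary.Any using (here; there)
open import Data.List.Relation.Unary.Unique.Propositional using (Unique)
import Data.List.Relation.Unary.AllPairs as AllPairs
open import Data.List.Relation.Unary.Unique.Propositional.Properties as Unique using ()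
open import Data.List.Membership.Propositional using (_∈_; find; lose)
open import Data.List.Membership.Propositional.Properties as ∈ using ()
open import Data.List.Membership.Propositional.Properties.WithK using (unique∧set⇒bag)
open import Data.List.Relation.Binary.BagAndSetEquality using (∼bag⇒↭)
open import Data.List.Relation.Binary.Permutation.Propositional as ↭ using (_↭_)
open import Data.List.Relation.Binary.Permutation.Propositional.Properties using (↭-length; filter-↭)
open import Data.Maybe as Maybe using (Maybe; just; nothing)
open import Data.Product using (_×_; Σ; ∃₂; _,_; proj₁; proj₂)
open import Data.Sum using (inj₁; inj₂)
open import Data.Empty using (⊥-elim)
open import Function using (id; _∘_; const; _⇔_; mk⇔; Equivalence)
open import Level using (0ℓ)
open import Relation.Nullary using (¬_; yes; no; ¬?)
open import Relation.Nullary.Decidable using (dec⇒maybe)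
open import Relation.Unary using (Pred; Decidable)
open import Relation.Binary.Definitions using (tri<; tri≈; tri>)
open import Relation.Binary.PropositionalEquality
open import Tactic.RingSolver using (solve; solve-∀)
import Tactic.RingSolver.Core.AlmostCommutativeRing as ACR

punchIn-mono-< : ∀ {n} (p : Fin (suc n)) {j k : Fin n} → j Fin.< k → punchIn p j Fin.< punchIn p k
punchIn-mono-< p {j} {k} j<k = Fin.≤∧≢⇒< (Fin.punchIn-mono-≤ p j k (ℕ.<⇒≤ j<k))
  (Fin.<⇒≢ j<k ∘ punchIn-injective p j k)

punchIn-cancel-< : ∀ {n} (p : Fin (suc n)) {j k : Fin n} → punchIn p j Fin.< punchIn p k → j Fin.< k
punchIn-cancel-< p {j} {k} pj<pk = Fin.≤∧≢⇒< (Fin.punchIn-cancel-≤ p j k (ℕ.<⇒≤ pj<pk))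
  (Fin.<⇒≢ pj<pk ∘ cong (punchIn p))

toℕ≤toℕ-punchIn : ∀ {n} (p : Fin (suc n)) (j : Fin n) → toℕ j ℕ.≤ toℕ (punchIn p j)
toℕ≤toℕ-punchIn Fin.zero    j          = ℕ.n≤1+n (toℕ j)
toℕ≤toℕ-punchIn (Fin.suc p) Fin.zero    = z≤n
toℕ≤toℕ-punchIn (Fin.suc p) (Fin.suc j) = s≤s (toℕ≤toℕ-punchIn p j)

toℕ-punchIn≤1+toℕ : ∀ {n} (p : Fin (suc n)) (j : Fin n) → toℕ (punchIn p j) ℕ.≤ suc (toℕ j)
toℕ-punchIn≤1+toℕ Fin.zero    j          = ℕ.≤-refl
toℕ-punchIn≤1+toℕ (Fin.suc p) Fin.zero    = z≤n
toℕ-punchIn≤1+toℕ (Fin.suc p) (Fin.suc j) = s≤s (toℕ-punchIn≤1+toℕ p j)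

toℕ-punchIn-below : ∀ {n} (c j : Fin n) → j Fin.≤ c → toℕ (punchIn (Fin.suc c) j) ≡ toℕ j
toℕ-punchIn-below c           Fin.zero    _       = refl
toℕ-punchIn-below (Fin.suc c) (Fin.suc j) (s≤s j≤c) = cong suc (toℕ-punchIn-below c j j≤c)

data PunchInView {n} (p : Fin (suc n)) : Fin (suc n) → Set where
  at       : PunchInView p p
  punchedIn : (j : Fin n) → PunchInView p (punchIn p j)

punchInView : ∀ {n} (p i : Fin (suc n)) → PunchInView p i
punchInView p i with p Fin.≟ i
... | yes refl = at
... | no p≢i   = subst (PunchInView p) (punchIn-punchOut p≢i) (punchedIn (punchOut p≢i))

lookup-extensionality : ∀ {A : Set} {n} {xs ys : Vec A n} → (∀ i → lookup xs i ≡ lookup ys i) → xs ≡ ys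
lookup-extensionality {xs = xs} {ys} eq =
  trans (sym (tabulate∘lookup xs)) (trans (tabulate-cong eq) (tabulate∘lookup ys))

tabulate-punchIn-↭ : ∀ {A : Set} {n} (f : Fin (suc n) → A) (p : Fin (suc n)) →
                     List.tabulate f ↭ f p ∷ List.tabulate (f ∘ punchIn p)
tabulate-punchIn-↭ f Fin.zero = ↭.refl
tabulate-punchIn-↭ {n = suc n} f (Fin.suc p) =
  ↭.trans (↭.prep (f Fin.zero) (tabulate-punchIn-↭ (f ∘ Fin.suc) p)) (↭.swap _ _ ↭.refl)

module _ {A B : Set} {P : Pred A 0ℓ} {Q : Pred B 0ℓ} (P? : Decidable P) (Q? : Decidable Q) where

  length-filter-tabulate-cong : ∀ {n} (f : Fin n → A) (g : Fin n → B) → (∀ i → P (f i) ⇔ Q (g i)) →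
    length (filter P? (List.tabulate f)) ≡ length (filter Q? (List.tabulate g))
  length-filter-tabulate-cong {zero} f g P⇔Q = refl
  length-filter-tabulate-cong {suc n} f g P⇔Q
    with P? (f Fin.zero) | Q? (g Fin.zero)
       | length-filter-tabulate-cong (f ∘ Fin.suc) (g ∘ Fin.suc) (P⇔Q ∘ Fin.suc)
  ... | yes _  | yes _  | eq = cong suc eq
  ... | no  _  | no  _  | eq = eq
  ... | yes p  | no ¬q  | _  = ⊥-elim (¬q (Equivalence.to (P⇔Q Fin.zero) p))
  ... | no ¬p  | yes q  | _  = ⊥-elim (¬p (Equivalence.from (P⇔Q Fin.zero) q))

module Punched {n} (b′ : Vec (Fin (suc n)) (suc n)) (b : Vec (Fin n) n) (p : Fin (suc n))
               (b′-punchIn : ∀ j → lookup b′ (punchIn p j) ≡ punchIn p (lookup b j)) where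

  same⁻ : ∀ j k → Same b′ (punchIn p j) (punchIn p k) → Same b j k
  same⁻ j k e = punchIn-injective p _ _ (trans (sym (b′-punchIn j)) (trans e (b′-punchIn k)))

  same⁺ : ∀ j k → Same b j k → Same b′ (punchIn p j) (punchIn p k)
  same⁺ j k e = trans (b′-punchIn j) (trans (cong (punchIn p) e) (sym (b′-punchIn k)))

  blockMin⁻ : ∀ j → IsBlockMin b′ (punchIn p j) → IsBlockMin b j
  blockMin⁻ j e = punchIn-injective p _ _ (trans (sym (b′-punchIn j)) e)

  blockMin⁺ : ∀ j → IsBlockMin b j → IsBlockMin b′ (punchIn p j)
  blockMin⁺ j e = trans (b′-punchIn j) (cong (punchIn p) e)

  private
    min′? : Decidable (IsBlockMin b′)
    min′? i = lookup b′ i Fin.≟ i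

    nBlocks-punchIn : length (filter min′? (p ∷ List.tabulate (punchIn p))) ≡ nBlocks b′
    nBlocks-punchIn = sym (↭-length (filter-↭ min′? (tabulate-punchIn-↭ id p)))

    nBlocks-rest : length (filter min′? (List.tabulate (punchIn p))) ≡ nBlocks b
    nBlocks-rest = length-filter-tabulate-cong min′? (λ i → lookup b i Fin.≟ i) (punchIn p) id
      (λ j → mk⇔ (blockMin⁻ j) (blockMin⁺ j))

  nBlocks-new : IsBlockMin b′ p → nBlocks b′ ≡ suc (nBlocks b)
  nBlocks-new new = trans (sym nBlocks-punchIn)
    (trans (cong length (List.filter-accept min′? new)) (cong suc nBlocks-rest))

  nBlocks-old : ¬ IsBlockMin b′ p → nBlocks b′ ≡ nBlocks b
  nBlocks-old old = trans (sym nBlocks-punchIn)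
    (trans (cong length (List.filter-reject min′? old)) nBlocks-rest)

module Valid {n} (b : Vec (Fin n) n) (u : Vec ℕ n) (valid : IsNCMton n (b , u)) where

  rep≤ : ∀ i → lookup b i Fin.≤ i
  rep≤ = proj₁ (proj₁ (proj₁ valid))

  rep-idem : ∀ i → lookup b (lookup b i) ≡ lookup b i
  rep-idem = proj₂ (proj₁ (proj₁ valid))

  nonCrossing : NonCrossing b
  nonCrossing = proj₂ (proj₁ valid)

  label-rep : ∀ i → lookup u i ≡ lookup u (lookup b i)
  label-rep = proj₁ (proj₂ valid)

  label≥1 : ∀ i → 1 ℕ.≤ lookup u i
  label≥1 i = proj₁ (proj₁ (proj₂ (proj₂ valid)) i)

  label≤nBlocks : ∀ i → lookup u i ℕ.≤ nBlocks b
  label≤nBlocks i = proj₂ (proj₁ (proj₂ (proj₂ valid)) i)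

  label-injective : ∀ v w → IsBlockMin b v → IsBlockMin b w → lookup u v ≡ lookup u w → v ≡ w
  label-injective = proj₁ (proj₂ (proj₂ (proj₂ valid)))

  label-monotone : ∀ v w → IsBlockMin b v → IsBlockMin b w → NestedIn b v w → lookup u w ℕ.< lookup u v
  label-monotone = proj₂ (proj₂ (proj₂ (proj₂ valid)))

insert : ∀ {n} → NCMton n → (p rep : Fin (suc n)) (label : ℕ) → NCMton (suc n)
insert x p r l = insertAt (Vec.map (punchIn p) (proj₁ x)) p r , insertAt (proj₂ x) p l

addSingleton : ∀ {n} → NCMton n → Fin (suc n) → NCMton (suc n)
addSingleton x p = insert x p p (suc (nBlocks (proj₁ x)))

extendBlock : ∀ {n} → NCMton n → Fin n → NCMton (suc n)
extendBlock x c = insert x (Fin.suc c) (punchIn (Fin.suc c) (lookup (proj₁ x) c)) (lookup (proj₂ x) c)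

module _ {n} (x : NCMton n) (p r : Fin (suc n)) (l : ℕ) where

  insert-rep-at : lookup (proj₁ (insert x p r l)) p ≡ r
  insert-rep-at = insertAt-lookup _ p r

  insert-rep-punchIn : ∀ j → lookup (proj₁ (insert x p r l)) (punchIn p j) ≡ punchIn p (lookup (proj₁ x) j)
  insert-rep-punchIn j = trans (insertAt-punchIn _ p r j) (lookup-map j (punchIn p) (proj₁ x))

  insert-label-at : lookup (proj₂ (insert x p r l)) p ≡ l
  insert-label-at = insertAt-lookup (proj₂ x) p l

  insert-label-punchIn : ∀ j → lookup (proj₂ (insert x p r l)) (punchIn p j) ≡ lookup (proj₂ x) j
  insert-label-punchIn = insertAt-punchIn (proj₂ x) p l

insert-injective : ∀ {n} {x y : NCMton n} {p r s l k} → insert x p r l ≡ insert y p s k → x ≡ y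
insert-injective {x = x} {y} {p} {r} {s} {l} {k} eq = cong₂ _,_
  (lookup-extensionality λ j → punchIn-injective p _ _
    (trans (sym (insert-rep-punchIn x p r l j))
    (trans (cong (λ z → lookup (proj₁ z) (punchIn p j)) eq) (insert-rep-punchIn y p s k j))))
  (lookup-extensionality λ j →
    trans (sym (insert-label-punchIn x p r l j))
    (trans (cong (λ z → lookup (proj₂ z) (punchIn p j)) eq) (insert-label-punchIn y p s k j)))

module AddSingleton {n} (b : Vec (Fin n) n) (u : Vec ℕ n) (valid : IsNCMton n (b , u)) (p : Fin (suc n)) where

  open Valid b u valid

  b′ : Vec (Fin (suc n)) (suc n)
  b′ = proj₁ (addSingleton (b , u) p)

  u′ : Vec ℕ (suc n)
  u′ = proj₂ (addSingleton (b , u) p)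

  m : ℕ
  m = nBlocks b

  b′-at : IsBlockMin b′ p
  b′-at = insert-rep-at (b , u) p p (suc m)

  b′-punchIn : ∀ j → lookup b′ (punchIn p j) ≡ punchIn p (lookup b j)
  b′-punchIn = insert-rep-punchIn (b , u) p p (suc m)

  u′-at : lookup u′ p ≡ suc m
  u′-at = insert-label-at (b , u) p p (suc m)

  u′-punchIn : ∀ j → lookup u′ (punchIn p j) ≡ lookup u j
  u′-punchIn = insert-label-punchIn (b , u) p p (suc m)

  open Punched b′ b p b′-punchIn

  nBlocks′ : nBlocks b′ ≡ suc m
  nBlocks′ = nBlocks-new b′-at

  singleton : ∀ i → Same b′ p i → i ≡ p
  singleton i e with punchInView p i
  ... | at = refl
  ... | punchedIn j = ⊥-elim (punchInᵢ≢i p (lookup b j) (trans (sym (b′-punchIn j)) (trans (sym e) b′-at)))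

  label-old<new : ∀ j → lookup u′ (punchIn p j) ℕ.< suc m
  label-old<new j = s≤s (subst (ℕ._≤ m) (sym (u′-punchIn j)) (label≤nBlocks j))

  label-new : ∀ i → lookup u′ i ≡ suc m → i ≡ p
  label-new i e with punchInView p i
  ... | at = refl
  ... | punchedIn j = ⊥-elim (ℕ.<⇒≢ (label-old<new j) e)

  rep≤′ : ∀ i → lookup b′ i Fin.≤ i
  rep≤′ i with punchInView p i
  ... | at = Fin.≤-reflexive b′-at
  ... | punchedIn j = subst (Fin._≤ punchIn p j) (sym (b′-punchIn j)) (Fin.punchIn-mono-≤ p _ _ (rep≤ j))

  rep-idem′ : ∀ i → lookup b′ (lookup b′ i) ≡ lookup b′ i
  rep-idem′ i with punchInView p i
  ... | at = cong (lookup b′) b′-at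
  ... | punchedIn j = trans (cong (lookup b′) (b′-punchIn j)) (same⁺ (lookup b j) j (rep-idem j))

  nonCrossing′ : NonCrossing b′
  nonCrossing′ a q c d a<q q<c c<d a~c q~d with punchInView p a | punchInView p c
  ... | at | _ = ⊥-elim (Fin.<-irrefl (sym (singleton c a~c)) (Fin.<-trans a<q q<c))
  ... | punchedIn a₀ | at = ⊥-elim (punchInᵢ≢i p a₀ (singleton _ (sym a~c)))
  ... | punchedIn a₀ | punchedIn c₀ with punchInView p q | punchInView p d
  ...   | at | _ = ⊥-elim (Fin.<-irrefl (sym (singleton d q~d)) (Fin.<-trans q<c c<d))
  ...   | punchedIn q₀ | at = ⊥-elim (punchInᵢ≢i p q₀ (singleton _ (sym q~d)))
  ...   | punchedIn q₀ | punchedIn d₀ = same⁺ a₀ q₀ (nonCrossing a₀ q₀ c₀ d₀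
          (punchIn-cancel-< p a<q) (punchIn-cancel-< p q<c) (punchIn-cancel-< p c<d)
          (same⁻ a₀ c₀ a~c) (same⁻ q₀ d₀ q~d))

  label-rep′ : ∀ i → lookup u′ i ≡ lookup u′ (lookup b′ i)
  label-rep′ i with punchInView p i
  ... | at = cong (lookup u′) (sym b′-at)
  ... | punchedIn j = trans (u′-punchIn j) (trans (label-rep j)
        (trans (sym (u′-punchIn (lookup b j))) (cong (lookup u′) (sym (b′-punchIn j)))))

  label-range′ : ∀ i → 1 ℕ.≤ lookup u′ i × lookup u′ i ℕ.≤ nBlocks b′
  label-range′ i with punchInView p i
  ... | at = subst (1 ℕ.≤_) (sym u′-at) (s≤s z≤n) , ℕ.≤-reflexive (trans u′-at (sym nBlocks′))
  ... | punchedIn j = subst (1 ℕ.≤_) (sym (u′-punchIn j)) (label≥1 j)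
                    , subst (lookup u′ (punchIn p j) ℕ.≤_) (sym nBlocks′) (ℕ.<⇒≤ (label-old<new j))

  label-injective′ : ∀ v w → IsBlockMin b′ v → IsBlockMin b′ w → lookup u′ v ≡ lookup u′ w → v ≡ w
  label-injective′ v w v-min w-min e with punchInView p v | punchInView p w
  ... | at | at = refl
  ... | at | punchedIn w₀ = sym (label-new _ (trans (sym e) u′-at))
  ... | punchedIn v₀ | at = label-new _ (trans e u′-at)
  ... | punchedIn v₀ | punchedIn w₀ = cong (punchIn p) (label-injective v₀ w₀ (blockMin⁻ v₀ v-min) (blockMin⁻ w₀ w-min)
        (trans (sym (u′-punchIn v₀)) (trans e (u′-punchIn w₀))))

  label-monotone′ : ∀ v w → IsBlockMin b′ v → IsBlockMin b′ w → NestedIn b′ v w → lookup u′ w ℕ.< lookup u′ v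
  label-monotone′ v w v-min w-min (w<v , k , k~w , inside) with punchInView p v | punchInView p w
  ... | at | at = ⊥-elim (Fin.<-irrefl refl w<v)
  ... | at | punchedIn w₀ = subst (lookup u′ (punchIn p w₀) ℕ.<_) (sym u′-at) (label-old<new w₀)
  ... | punchedIn v₀ | at = ⊥-elim (Fin.<-asym w<v (subst (punchIn p v₀ Fin.<_) (singleton k (sym k~w)) (inside _ refl)))
  ... | punchedIn v₀ | punchedIn w₀ with punchInView p k
  ...   | at = ⊥-elim (punchInᵢ≢i p w₀ (singleton _ k~w))
  ...   | punchedIn k₀ = subst₂ ℕ._<_ (sym (u′-punchIn w₀)) (sym (u′-punchIn v₀))
          (label-monotone v₀ w₀ (blockMin⁻ v₀ v-min) (blockMin⁻ w₀ w-min)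
            (punchIn-cancel-< p w<v , k₀ , same⁻ k₀ w₀ k~w ,
             λ j j~v → punchIn-cancel-< p (inside (punchIn p j) (same⁺ j v₀ j~v))))

  valid′ : IsNCMton (suc n) (addSingleton (b , u) p)
  valid′ = ((rep≤′ , rep-idem′) , nonCrossing′) , (label-rep′ , label-range′ , label-injective′ , label-monotone′)

pinch-suc : ∀ {n} (c : Fin n) → Fin.pinch c (Fin.suc c) ≡ c
pinch-suc {suc n} Fin.zero    = refl
pinch-suc {suc n} (Fin.suc c) = cong Fin.suc (pinch-suc c)

pinch-punchIn-suc : ∀ {n} (c j : Fin n) → Fin.pinch c (punchIn (Fin.suc c) j) ≡ j
pinch-punchIn-suc {suc n} c           Fin.zero    = refl
pinch-punchIn-suc {suc n} Fin.zero    (Fin.suc j) = refl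
pinch-punchIn-suc {suc n} (Fin.suc c) (Fin.suc j) = cong Fin.suc (pinch-punchIn-suc c j)

module ExtendBlock {n} (b : Vec (Fin n) n) (u : Vec ℕ n) (valid : IsNCMton n (b , u)) (c : Fin n) where

  open Valid b u valid

  b′ : Vec (Fin (suc n)) (suc n)
  b′ = proj₁ (extendBlock (b , u) c)

  u′ : Vec ℕ (suc n)
  u′ = proj₂ (extendBlock (b , u) c)

  p : Fin (suc n)
  p = Fin.suc c

  r : Fin (suc n)
  r = punchIn p (lookup b c)

  -- Both vectors factor through the map Fin (suc n) → Fin n merging the new point p = c + 1 into c.
  collapse : Fin (suc n) → Fin n
  collapse = Fin.pinch c

  collapse-punchIn : ∀ j → collapse (punchIn p j) ≡ j
  collapse-punchIn = pinch-punchIn-suc c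

  b′-punchIn : ∀ j → lookup b′ (punchIn p j) ≡ punchIn p (lookup b j)
  b′-punchIn = insert-rep-punchIn (b , u) p r (lookup u c)

  b′-collapse : ∀ i → lookup b′ i ≡ punchIn p (lookup b (collapse i))
  b′-collapse i with punchInView p i
  ... | at = trans (insert-rep-at (b , u) p r (lookup u c)) (cong (punchIn p ∘ lookup b) (sym (pinch-suc c)))
  ... | punchedIn j = trans (b′-punchIn j) (cong (punchIn p ∘ lookup b) (sym (collapse-punchIn j)))

  u′-collapse : ∀ i → lookup u′ i ≡ lookup u (collapse i)
  u′-collapse i with punchInView p i
  ... | at = trans (insert-label-at (b , u) p r (lookup u c)) (cong (lookup u) (sym (pinch-suc c)))
  ... | punchedIn j = trans (insert-label-punchIn (b , u) p r (lookup u c) j) (cong (lookup u) (sym (collapse-punchIn j)))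

  rep-new≤c : lookup b′ p Fin.≤ c
  rep-new≤c = subst (ℕ._≤ toℕ c) (sym (trans (cong toℕ (b′-collapse p)) (toℕ-punchIn-below c _ rep-c≤c))) rep-c≤c
    where
    rep-c≤c : lookup b (collapse p) Fin.≤ c
    rep-c≤c = subst (λ i → lookup b i Fin.≤ c) (sym (pinch-suc c)) (rep≤ c)

  new-not-min : ¬ IsBlockMin b′ p
  new-not-min e = ℕ.<-irrefl refl (subst (Fin._≤ c) e rep-new≤c)

  nBlocks′ : nBlocks b′ ≡ nBlocks b
  nBlocks′ = Punched.nBlocks-old b′ b p b′-punchIn new-not-min

  same⁻ : ∀ i k → Same b′ i k → Same b (collapse i) (collapse k)
  same⁻ i k e = punchIn-injective p _ _ (trans (sym (b′-collapse i)) (trans e (b′-collapse k)))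

  same⁺ : ∀ i k → Same b (collapse i) (collapse k) → Same b′ i k
  same⁺ i k e = trans (b′-collapse i) (trans (cong (punchIn p) e) (sym (b′-collapse k)))

  collapse-rep : ∀ i → collapse (lookup b′ i) ≡ lookup b (collapse i)
  collapse-rep i = trans (cong collapse (b′-collapse i)) (collapse-punchIn _)

  blockMin⁻ : ∀ v → IsBlockMin b′ v → IsBlockMin b (collapse v)
  blockMin⁻ v e = trans (sym (collapse-rep v)) (cong collapse e)

  blockMin-punchIn : ∀ v → IsBlockMin b′ v → v ≡ punchIn p (collapse v)
  blockMin-punchIn v e = trans (sym e) (trans (b′-collapse v) (cong (punchIn p) (blockMin⁻ v e)))

  blockMin-collapse-injective : ∀ v w → IsBlockMin b′ v → IsBlockMin b′ w → collapse v ≡ collapse w → v ≡ w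
  blockMin-collapse-injective v w v-min w-min e =
    trans (blockMin-punchIn v v-min) (trans (cong (punchIn p) e) (sym (blockMin-punchIn w w-min)))

  collapse-mono : ∀ {i k} → i Fin.≤ k → collapse i Fin.≤ collapse k
  collapse-mono = Fin.pinch-mono-≤ c

  rep≤′ : ∀ i → lookup b′ i Fin.≤ i
  rep≤′ i with punchInView p i
  ... | at = ℕ.m≤n⇒m≤1+n rep-new≤c
  ... | punchedIn j = subst (Fin._≤ punchIn p j) (sym (b′-punchIn j)) (Fin.punchIn-mono-≤ p _ _ (rep≤ j))

  rep-idem′ : ∀ i → lookup b′ (lookup b′ i) ≡ lookup b′ i
  rep-idem′ i = same⁺ (lookup b′ i) i (trans (cong (lookup b) (collapse-rep i)) (rep-idem (collapse i)))

  -- A crossing in b′ either collapses to a crossing in b, or two of its consecutive points merge.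
  nonCrossing′ : NonCrossing b′
  nonCrossing′ a q c′ d a<q q<c c<d a~c q~d
    with ℕ.m≤n⇒m<n∨m≡n (collapse-mono (ℕ.<⇒≤ a<q))
       | ℕ.m≤n⇒m<n∨m≡n (collapse-mono (ℕ.<⇒≤ q<c))
       | ℕ.m≤n⇒m<n∨m≡n (collapse-mono (ℕ.<⇒≤ c<d))
  ... | inj₂ a=q | _ | _ = same⁺ a q (cong (lookup b) (toℕ-injective a=q))
  ... | inj₁ _ | inj₂ q=c | _ = trans a~c (sym (same⁺ q c′ (cong (lookup b) (toℕ-injective q=c))))
  ... | inj₁ _ | inj₁ _ | inj₂ c=d =
        trans a~c (trans (same⁺ c′ d (cong (lookup b) (toℕ-injective c=d))) (sym q~d))
  ... | inj₁ a<q′ | inj₁ q<c′ | inj₁ c<d′ =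
        same⁺ a q (nonCrossing _ _ _ _ a<q′ q<c′ c<d′ (same⁻ a c′ a~c) (same⁻ q d q~d))

  label-rep′ : ∀ i → lookup u′ i ≡ lookup u′ (lookup b′ i)
  label-rep′ i = trans (u′-collapse i) (trans (label-rep (collapse i))
    (trans (cong (lookup u) (sym (collapse-rep i))) (sym (u′-collapse (lookup b′ i)))))

  label-range′ : ∀ i → 1 ℕ.≤ lookup u′ i × lookup u′ i ℕ.≤ nBlocks b′
  label-range′ i = subst (1 ℕ.≤_) (sym (u′-collapse i)) (label≥1 (collapse i))
                 , subst₂ ℕ._≤_ (sym (u′-collapse i)) (sym nBlocks′) (label≤nBlocks (collapse i))

  label-injective′ : ∀ v w → IsBlockMin b′ v → IsBlockMin b′ w → lookup u′ v ≡ lookup u′ w → v ≡ w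
  label-injective′ v w v-min w-min e = blockMin-collapse-injective v w v-min w-min
    (label-injective _ _ (blockMin⁻ v v-min) (blockMin⁻ w w-min)
      (trans (sym (u′-collapse v)) (trans e (u′-collapse w))))

  label-monotone′ : ∀ v w → IsBlockMin b′ v → IsBlockMin b′ w → NestedIn b′ v w → lookup u′ w ℕ.< lookup u′ v
  label-monotone′ v w v-min w-min (w<v , k , k~w , inside) = subst₂ ℕ._<_ (sym (u′-collapse w)) (sym (u′-collapse v))
      (label-monotone _ _ (blockMin⁻ v v-min) (blockMin⁻ w w-min) (w<v′ , collapse k , same⁻ k w k~w , inside′))
    where
    v≢w : collapse v ≢ collapse w
    v≢w e = Fin.<-irrefl (sym (blockMin-collapse-injective v w v-min w-min e)) w<v
    w<v′ : collapse w Fin.< collapse v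
    w<v′ = Fin.≤∧≢⇒< (collapse-mono (ℕ.<⇒≤ w<v)) (v≢w ∘ sym)
    inside′ : ∀ j → Same b j (collapse v) → j Fin.< collapse k
    inside′ j j~v = Fin.≤∧≢⇒<
      (subst (Fin._≤ collapse k) (collapse-punchIn j) (collapse-mono (ℕ.<⇒≤ (inside (punchIn p j) j~v′))))
      (λ j=k → v≢w (trans (sym (blockMin⁻ v v-min)) (trans (sym j~v)
         (trans (cong (lookup b) j=k) (trans (same⁻ k w k~w) (blockMin⁻ w w-min))))))
      where
      j~v′ : Same b′ (punchIn p j) v
      j~v′ = same⁺ (punchIn p j) v (subst (λ i → Same b i (collapse v)) (sym (collapse-punchIn j)) j~v)

  valid′ : IsNCMton (suc n) (extendBlock (b , u) c)
  valid′ = ((rep≤′ , rep-idem′) , nonCrossing′) , (label-rep′ , label-range′ , label-injective′ , label-monotone′)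

record IsLastIndex {n} (u : Vec ℕ n) (m : ℕ) (c : Fin n) : Set where
  constructor _,_
  field
    hit          : lookup u c ≡ m
    nothingAfter : ∀ i → c Fin.< i → lookup u i ≢ m

open IsLastIndex public

lastIndex : ∀ {n} → Vec ℕ n → ℕ → Maybe (Fin n)
lastIndex Vec.[]       m = nothing
lastIndex (x Vec.∷ u) m with lastIndex u m | x ℕ.≟ m
... | just c  | _     = just (Fin.suc c)
... | nothing | yes _ = just Fin.zero
... | nothing | no _  = nothing

data LastIndexView {n} (u : Vec ℕ n) (m : ℕ) : Maybe (Fin n) → Set where
  found  : ∀ c → IsLastIndex u m c → LastIndexView u m (just c)
  absent : (∀ i → lookup u i ≢ m) → LastIndexView u m nothing

lastIndexView : ∀ {n} (u : Vec ℕ n) m → LastIndexView u m (lastIndex u m)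
lastIndexView Vec.[]       m = absent (λ ())
lastIndexView (x Vec.∷ u) m with lastIndex u m | lastIndexView u m | x ℕ.≟ m
... | just c  | found .c (u-c , after) | _ = found (Fin.suc c) (u-c , λ { (Fin.suc i) (s≤s c<i) → after i c<i })
... | nothing | absent none | yes x=m = found Fin.zero (x=m , λ { (Fin.suc i) _ → none i })
... | nothing | absent none | no x≢m = absent λ { Fin.zero → x≢m ; (Fin.suc i) → none i }

IsLastIndex-unique : ∀ {n} {u : Vec ℕ n} {m c c′} → IsLastIndex u m c → IsLastIndex u m c′ → c ≡ c′
IsLastIndex-unique {c = c} {c′} (u-c , after) (u-c′ , after′) with Fin.<-cmp c c′
... | tri< c<c′ _ _ = ⊥-elim (after c′ c<c′ u-c′)
... | tri≈ _ c=c′ _ = c=c′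
... | tri> _ _ c′<c = ⊥-elim (after′ c c′<c u-c)

lastIndex-complete : ∀ {n} (u : Vec ℕ n) m c → IsLastIndex u m c → lastIndex u m ≡ just c
lastIndex-complete u m c last with lastIndex u m | lastIndexView u m
... | just c′ | found .c′ last′ = cong just (IsLastIndex-unique last′ last)
... | nothing | absent none = ⊥-elim (none c (hit last))

module _ (a : ℕ) where

  private
    ≢a? : Decidable (_≢ a)
    ≢a? x = ¬? (x ℕ.≟ a)

  length≤1+length-filter-≢ : ∀ (xs : List ℕ) → Unique xs → length xs ℕ.≤ suc (length (filter ≢a? xs))
  length≤1+length-filter-≢ [] _ = z≤n
  length≤1+length-filter-≢ (x ∷ xs) (x∉xs AllPairs.∷ unique) with x ℕ.≟ a
  ... | yes refl = s≤s (ℕ.≤-reflexive (sym (cong length (trans (List.filter-reject ≢a? (λ x≢x → x≢x refl))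
                     (List.filter-all ≢a? (All.map (λ x≢y y=x → x≢y (sym y=x)) x∉xs))))))
  ... | no x≢a = subst (λ ys → suc (length xs) ℕ.≤ suc (length ys)) (sym (List.filter-accept ≢a? x≢a))
                   (s≤s (length≤1+length-filter-≢ xs unique))

length-unique-bounded : ∀ K (xs : List ℕ) → Unique xs → All (λ x → 1 ℕ.≤ x × x ℕ.≤ K) xs → length xs ℕ.≤ K
length-unique-bounded zero    []       _ _ = z≤n
length-unique-bounded zero    (x ∷ xs) _ ((1≤x , x≤0) All.∷ _) = ⊥-elim (ℕ.<-irrefl refl (ℕ.≤-trans 1≤x x≤0))
length-unique-bounded (suc K) xs unique bounded = ℕ.≤-trans (length≤1+length-filter-≢ (suc K) xs unique)
  (s≤s (length-unique-bounded K _ (Unique.filter⁺ ≢K? unique)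
    (All.zipWith (λ (bound , x≢1+K) → bound x≢1+K) (All.filter⁺ ≢K? bounded′ , All.all-filter ≢K? xs))))
  where
  ≢K? : Decidable (_≢ suc K)
  ≢K? x = ¬? (x ℕ.≟ suc K)
  bounded′ : All (λ x → x ≢ suc K → 1 ℕ.≤ x × x ℕ.≤ K) xs
  bounded′ = All.map (λ (1≤x , x≤1+K) x≢1+K → 1≤x , ℕ.≤-pred (ℕ.≤∧≢⇒< x≤1+K x≢1+K)) bounded

unique-map⁺-∈ : ∀ {A B : Set} (f : A → B) {xs : List A} → Unique xs →
                (∀ {x y} → x ∈ xs → y ∈ xs → f x ≡ f y → x ≡ y) → Unique (map f xs)
unique-map⁺-∈ f {[]}     AllPairs.[]                _   = AllPairs.[]
unique-map⁺-∈ f {x ∷ xs} (x∉xs AllPairs.∷ unique) inj =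
  All.map⁺ (All.tabulate λ y∈ fx=fy → All.lookup x∉xs y∈ (inj (here refl) (there y∈) fx=fy))
  AllPairs.∷ unique-map⁺-∈ f unique (λ x∈ y∈ → inj (there x∈) (there y∈))

-- The labels of the blocks are distinct and lie in 1 … nBlocks b, so by pigeonhole one of them is nBlocks b.
topLabel-lastIndex : ∀ {n} (b : Vec (Fin (suc n)) (suc n)) (u : Vec ℕ (suc n)) → IsNCMton (suc n) (b , u) →
                     Σ (Fin (suc n)) (IsLastIndex u (nBlocks b))
topLabel-lastIndex {n} b u valid with lastIndex u (nBlocks b) | lastIndexView u (nBlocks b)
... | just c  | found .c last = c , last
... | nothing | absent none = ⊥-elim (ℕ.<-irrefl refl (ℕ.≤-trans m≤labels labels≤m-1))
  where
  open Valid b u valid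
  m : ℕ
  m = nBlocks b
  min? : Decidable (IsBlockMin b)
  min? i = lookup b i Fin.≟ i
  labels : List ℕ
  labels = map (lookup u) (filter min? (allFin (suc n)))
  m≤labels : suc (ℕ.pred m) ℕ.≤ length labels
  m≤labels = ℕ.≤-reflexive (trans (ℕ.suc-pred m {{ℕ.>-nonZero (ℕ.≤-trans (label≥1 Fin.zero) (label≤nBlocks Fin.zero))}})
                                   (sym (List.length-map (lookup u) (filter min? (allFin (suc n))))))
  labels≤m-1 : length labels ℕ.≤ ℕ.pred m
  labels≤m-1 = length-unique-bounded (ℕ.pred m) labels
    (unique-map⁺-∈ (lookup u) (Unique.filter⁺ min? (Unique.allFin⁺ (suc n)))
      λ v∈ w∈ → label-injective _ _ (proj₂ (∈.∈-filter⁻ min? v∈)) (proj₂ (∈.∈-filter⁻ min? w∈)))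
    (All.map⁺ (All.tabulate λ {i} _ → label≥1 i , ℕ.<⇒≤pred (ℕ.≤∧≢⇒< (label≤nBlocks i) (none i))))

module Restrict {n} (b′ : Vec (Fin (suc n)) (suc n)) (u′ : Vec ℕ (suc n)) (valid′ : IsNCMton (suc n) (b′ , u′))
                (c : Fin (suc n)) (c-last : IsLastIndex u′ (nBlocks b′) c) where

  module V′ = Valid b′ u′ valid′

  m′ : ℕ
  m′ = nBlocks b′

  -- A point whose block minimum is c carries the top label, so it can lie neither before nor after c.
  rep≢c : ∀ j → lookup b′ (punchIn c j) ≢ c
  rep≢c j e = punchInᵢ≢i c j (Fin.≤-antisym j≤c c≤j)
    where
    c≤j : c Fin.≤ punchIn c j
    c≤j = subst (Fin._≤ punchIn c j) e (V′.rep≤ (punchIn c j))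
    j≤c : punchIn c j Fin.≤ c
    j≤c = ℕ.≮⇒≥ λ c<j → nothingAfter c-last _ c<j
      (trans (V′.label-rep (punchIn c j)) (trans (cong (lookup u′) e) (hit c-last)))

  b : Vec (Fin n) n
  b = Vec.tabulate (λ j → punchOut (rep≢c j ∘ sym))

  u : Vec ℕ n
  u = Vec.tabulate (λ j → lookup u′ (punchIn c j))

  b′-punchIn : ∀ j → lookup b′ (punchIn c j) ≡ punchIn c (lookup b j)
  b′-punchIn j = sym (trans (cong (punchIn c) (lookup∘tabulate _ j)) (punchIn-punchOut _))

  u′-punchIn : ∀ j → lookup u′ (punchIn c j) ≡ lookup u j
  u′-punchIn j = sym (lookup∘tabulate _ j)

  open Punched b′ b c b′-punchIn public

  -- c-before ensures that putting c back does not undo a nesting of blocks of b.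
  module _ (label≤nBlocks : ∀ j → lookup u j ℕ.≤ nBlocks b)
           (c-before : ∀ j k → Same b′ c (punchIn c j) → (∀ i → Same b i j → i Fin.< k) → c Fin.< punchIn c k) where

    rep≤ : ∀ j → lookup b j Fin.≤ j
    rep≤ j = Fin.punchIn-cancel-≤ c _ _ (subst (Fin._≤ punchIn c j) (b′-punchIn j) (V′.rep≤ (punchIn c j)))

    rep-idem : ∀ j → lookup b (lookup b j) ≡ lookup b j
    rep-idem j = same⁻ (lookup b j) j (trans (cong (lookup b′) (sym (b′-punchIn j))) (V′.rep-idem (punchIn c j)))

    nonCrossing : NonCrossing b
    nonCrossing a q c₀ d a<q q<c c<d a~c q~d = same⁻ a q (V′.nonCrossing _ _ _ _
      (punchIn-mono-< c a<q) (punchIn-mono-< c q<c) (punchIn-mono-< c c<d) (same⁺ a c₀ a~c) (same⁺ q d q~d))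

    label-rep : ∀ j → lookup u j ≡ lookup u (lookup b j)
    label-rep j = trans (sym (u′-punchIn j)) (trans (V′.label-rep (punchIn c j))
      (trans (cong (lookup u′) (b′-punchIn j)) (u′-punchIn (lookup b j))))

    label-range : ∀ j → 1 ℕ.≤ lookup u j × lookup u j ℕ.≤ nBlocks b
    label-range j = subst (1 ℕ.≤_) (u′-punchIn j) (V′.label≥1 (punchIn c j)) , label≤nBlocks j

    label-injective : ∀ v w → IsBlockMin b v → IsBlockMin b w → lookup u v ≡ lookup u w → v ≡ w
    label-injective v w v-min w-min e = punchIn-injective c _ _ (V′.label-injective _ _ (blockMin⁺ v v-min) (blockMin⁺ w w-min)
      (trans (u′-punchIn v) (trans e (sym (u′-punchIn w)))))

    label-monotone : ∀ v w → IsBlockMin b v → IsBlockMin b w → NestedIn b v w → lookup u w ℕ.< lookup u v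
    label-monotone v w v-min w-min (w<v , k , k~w , inside) = subst₂ ℕ._<_ (u′-punchIn w) (u′-punchIn v)
      (V′.label-monotone _ _ (blockMin⁺ v v-min) (blockMin⁺ w w-min)
        (punchIn-mono-< c w<v , punchIn c k , same⁺ k w k~w , inside′))
      where
      inside′ : ∀ i → Same b′ i (punchIn c v) → i Fin.< punchIn c k
      inside′ i i~v with punchInView c i
      ... | at = c-before v k i~v inside
      ... | punchedIn j = punchIn-mono-< c (inside j (same⁻ j v i~v))

    valid : IsNCMton n (b , u)
    valid = ((rep≤ , rep-idem) , nonCrossing) , (label-rep , label-range , label-injective , label-monotone)

restrict-singleton : ∀ {n} (b′ : Vec (Fin (suc n)) (suc n)) (u′ : Vec ℕ (suc n)) (valid′ : IsNCMton (suc n) (b′ , u′))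
  (c : Fin (suc n)) (c-last : IsLastIndex u′ (nBlocks b′) c) → IsBlockMin b′ c →
  let open Restrict b′ u′ valid′ c c-last in IsNCMton n (b , u) × (b′ , u′) ≡ addSingleton (b , u) c
restrict-singleton {n} b′ u′ valid′ c c-last c-min =
  valid label≤nBlocks (λ j _ c~j _ → ⊥-elim (rep≢c j (trans (sym c~j) c-min))) ,
  cong₂ _,_ (lookup-extensionality b′-at) (lookup-extensionality u′-at)
  where
  open Restrict b′ u′ valid′ c c-last
  x : NCMton n
  x = (b , u)
  nBlocks′ : m′ ≡ suc (nBlocks b)
  nBlocks′ = nBlocks-new c-min
  label≤nBlocks : ∀ j → lookup u j ℕ.≤ nBlocks b
  label≤nBlocks j = subst (ℕ._≤ nBlocks b) (u′-punchIn j)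
    (ℕ.≤-pred (subst (suc (lookup u′ (punchIn c j)) ℕ.≤_) nBlocks′ (ℕ.≤∧≢⇒< (V′.label≤nBlocks _) not-top)))
    where
    not-top : lookup u′ (punchIn c j) ≢ m′
    not-top e = rep≢c j (V′.label-injective _ c (V′.rep-idem (punchIn c j)) c-min
      (trans (sym (V′.label-rep (punchIn c j))) (trans e (sym (hit c-last)))))
  b′-at : ∀ i → lookup b′ i ≡ lookup (proj₁ (addSingleton x c)) i
  b′-at i with punchInView c i
  ... | at = trans c-min (sym (insert-rep-at x c c (suc (nBlocks b))))
  ... | punchedIn j = trans (b′-punchIn j) (sym (insert-rep-punchIn x c c (suc (nBlocks b)) j))
  u′-at : ∀ i → lookup u′ i ≡ lookup (proj₂ (addSingleton x c)) i
  u′-at i with punchInView c i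
  ... | at = trans (hit c-last) (trans nBlocks′ (sym (insert-label-at x c c (suc (nBlocks b)))))
  ... | punchedIn j = trans (u′-punchIn j) (sym (insert-label-punchIn x c c (suc (nBlocks b)) j))

-- The block with the top label has no block nested inside it, so it is an interval of consecutive points.
module TopBlock {n} (b′ : Vec (Fin (suc n)) (suc n)) (u′ : Vec ℕ (suc n)) (valid′ : IsNCMton (suc n) (b′ , u′))
                (c₀ : Fin n) (c-last : IsLastIndex u′ (nBlocks b′) (Fin.suc c₀))
                (c-not-min : ¬ IsBlockMin b′ (Fin.suc c₀)) where

  open Valid b′ u′ valid′
  private
    c d a e : Fin (suc n)
    c = Fin.suc c₀
    d = punchIn c c₀
    a = lookup b′ c
    e = lookup b′ d

    a~c : Same b′ a c
    a~c = rep-idem c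

    toℕ-d : toℕ d ≡ toℕ c₀
    toℕ-d = toℕ-punchIn-below c₀ c₀ Fin.≤-refl

    d<c : d Fin.< c
    d<c = subst (ℕ._< toℕ c) (sym toℕ-d) (Fin.i<1+i c₀)

    a<d : ¬ Same b′ d c → a Fin.< d
    a<d d≁c = Fin.≤∧≢⇒< (subst (toℕ a ℕ.≤_) (sym toℕ-d) (ℕ.≤-pred (Fin.≤∧≢⇒< (rep≤ c) c-not-min)))
      (λ a=d → d≁c (trans (cong (lookup b′) (sym a=d)) a~c))

    inside : ¬ Same b′ d c → ∀ j → Same b′ j e → j Fin.< c
    inside d≁c j j~e with Fin.<-cmp j c
    ... | tri< j<c _ _ = j<c
    ... | tri≈ _ j=c _ = ⊥-elim (d≁c (trans (sym (rep-idem d)) (trans (sym j~e) (cong (lookup b′) j=c))))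
    ... | tri> _ _ c<j =
          ⊥-elim (d≁c (trans (sym (nonCrossing a d c j (a<d d≁c) d<c c<j a~c (trans (sym (rep-idem d)) (sym j~e)))) a~c))

  predecessor-in-top-block : Same b′ d c
  predecessor-in-top-block with lookup b′ d Fin.≟ lookup b′ c
  ... | yes d~c = d~c
  ... | no d≁c with Fin.<-cmp e a
  ...   | tri< e<a _ _ = ⊥-elim (d≁c (trans (sym (rep-idem d)) (trans (nonCrossing e a d c e<a (a<d d≁c) d<c (rep-idem d) a~c) a~c)))
  ...   | tri≈ _ e=a _ = ⊥-elim (d≁c e=a)
  ...   | tri> _ _ a<e = ⊥-elim (ℕ.<-irrefl refl (ℕ.≤-trans
          (subst (ℕ._< lookup u′ e) (trans (sym (label-rep c)) (hit c-last))
            (label-monotone e a (rep-idem d) (rep-idem c) (a<e , c , sym a~c , inside d≁c)))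
          (label≤nBlocks e)))

restrict-extension : ∀ {n} (b′ : Vec (Fin (suc n)) (suc n)) (u′ : Vec ℕ (suc n)) (valid′ : IsNCMton (suc n) (b′ , u′))
  (c₀ : Fin n) (c-last : IsLastIndex u′ (nBlocks b′) (Fin.suc c₀)) → ¬ IsBlockMin b′ (Fin.suc c₀) →
  let open Restrict b′ u′ valid′ (Fin.suc c₀) c-last in
  IsNCMton n (b , u) × IsLastIndex u (nBlocks b) c₀ × (b′ , u′) ≡ extendBlock (b , u) c₀
restrict-extension {n} b′ u′ valid′ c₀ c-last c-not-min =
  valid label≤nBlocks c-before , c₀-last , cong₂ _,_ (lookup-extensionality b′-at) (lookup-extensionality u′-at)
  where
  open Restrict b′ u′ valid′ (Fin.suc c₀) c-last
  x : NCMton n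
  x = (b , u)
  c d : Fin (suc n)
  c = Fin.suc c₀
  d = punchIn c c₀
  d~c : Same b′ d c
  d~c = TopBlock.predecessor-in-top-block b′ u′ valid′ c₀ c-last c-not-min
  nBlocks′ : m′ ≡ nBlocks b
  nBlocks′ = nBlocks-old c-not-min
  label≤nBlocks : ∀ j → lookup u j ℕ.≤ nBlocks b
  label≤nBlocks j = subst₂ ℕ._≤_ (u′-punchIn j) nBlocks′ (V′.label≤nBlocks (punchIn c j))
  c-before : ∀ j k → Same b′ c (punchIn c j) → (∀ i → Same b i j → i Fin.< k) → c Fin.< punchIn c k
  c-before j k c~j inside = Fin.≤∧≢⇒< (ℕ.≤-trans (inside c₀ (same⁻ c₀ j (trans d~c c~j))) (toℕ≤toℕ-punchIn c k))
    (λ c=k → punchInᵢ≢i c k (sym c=k))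
  label-c : lookup u′ c ≡ lookup u c₀
  label-c = trans (V′.label-rep c) (trans (cong (lookup u′) (sym d~c)) (trans (sym (V′.label-rep d)) (u′-punchIn c₀)))
  c₀-last : IsLastIndex u (nBlocks b) c₀
  c₀-last = trans (sym label-c) (trans (hit c-last) nBlocks′)
          , λ i c₀<i e → nothingAfter c-last (punchIn c i)
              (Fin.≤∧≢⇒< (ℕ.≤-trans c₀<i (toℕ≤toℕ-punchIn c i)) (λ c=i → punchInᵢ≢i c i (sym c=i)))
              (trans (u′-punchIn i) (trans e (sym nBlocks′)))
  b′-at : ∀ i → lookup b′ i ≡ lookup (proj₁ (extendBlock x c₀)) i
  b′-at i with punchInView c i
  ... | at = trans (sym d~c) (trans (b′-punchIn c₀) (sym (insert-rep-at x c _ (lookup u c₀))))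
  ... | punchedIn j = trans (b′-punchIn j) (sym (insert-rep-punchIn x c (punchIn c (lookup b c₀)) (lookup u c₀) j))
  u′-at : ∀ i → lookup u′ i ≡ lookup (proj₂ (extendBlock x c₀)) i
  u′-at i with punchInView c i
  ... | at = trans label-c (sym (insert-label-at x c (punchIn c (lookup b c₀)) _))
  ... | punchedIn j = trans (u′-punchIn j) (sym (insert-label-punchIn x c (punchIn c (lookup b c₀)) (lookup u c₀) j))

extensions : ∀ {n} → NCMton n → List (NCMton (suc n))
extensions x = List.fromMaybe (Maybe.map (extendBlock x) (lastIndex (proj₂ x) (nBlocks (proj₁ x))))

children : ∀ {n} → NCMton n → List (NCMton (suc n))
children {n} x = extensions x ++ map (addSingleton x) (allFin (suc n))

enum : ∀ n → List (NCMton n)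
enum zero    = (Vec.[] , Vec.[]) ∷ []
enum (suc n) = concatMap children (enum n)

data ChildOf {n} (x : NCMton n) : NCMton (suc n) → Set where
  singletonChild : ∀ p → ChildOf x (addSingleton x p)
  extensionChild : ∀ c → IsLastIndex (proj₂ x) (nBlocks (proj₁ x)) c → ChildOf x (extendBlock x c)

childOf : ∀ {n} {x : NCMton n} {y} → y ∈ children x → ChildOf x y
childOf {n} {x} y∈ with ∈.∈-++⁻ (extensions x) y∈
... | inj₂ y∈singletons with ∈.∈-map⁻ (addSingleton x) {xs = allFin (suc n)} y∈singletons
...   | p , _ , refl = singletonChild p
childOf {n} {x} y∈ | inj₁ y∈extensions
  with lastIndex (proj₂ x) (nBlocks (proj₁ x)) | lastIndexView (proj₂ x) (nBlocks (proj₁ x))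
... | just c | found .c c-last with y∈extensions
...   | here refl = extensionChild c c-last

insertionPoint : ∀ {n} {x : NCMton n} {y} → ChildOf x y → Fin (suc n)
insertionPoint (singletonChild p)   = p
insertionPoint (extensionChild c _) = Fin.suc c

child-insert : ∀ {n} {x : NCMton n} {y} (child : ChildOf x y) → ∃₂ λ r l → y ≡ insert x (insertionPoint child) r l
child-insert (singletonChild p)   = _ , _ , refl
child-insert (extensionChild c _) = _ , _ , refl

module _ {n} (b : Vec (Fin n) n) (u : Vec ℕ n) (valid : IsNCMton n (b , u)) where

  child-valid : ∀ {y} → ChildOf (b , u) y → IsNCMton (suc n) y
  child-valid (singletonChild p)   = AddSingleton.valid′ b u valid p
  child-valid (extensionChild c _) = ExtendBlock.valid′ b u valid c

  child-lastIndex : ∀ {y} (child : ChildOf (b , u) y) → IsLastIndex (proj₂ y) (nBlocks (proj₁ y)) (insertionPoint child)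
  child-lastIndex (singletonChild p) =
    trans u′-at (sym nBlocks′) , λ i p<i e → Fin.<-irrefl (sym (label-new i (trans e nBlocks′))) p<i
    where open AddSingleton b u valid p
  child-lastIndex (extensionChild c (u-c , after)) =
    trans (u′-collapse p) (trans (cong (lookup u) (pinch-suc c)) (trans u-c (sym nBlocks′))) , later
    where
    open ExtendBlock b u valid c
    later : ∀ i → p Fin.< i → lookup u′ i ≢ nBlocks b′
    later i p<i e with punchInView p i
    ... | at = Fin.<-irrefl refl p<i
    ... | punchedIn j = after j (ℕ.≤-pred (ℕ.≤-trans p<i (toℕ-punchIn≤1+toℕ p j)))
          (trans (sym (trans (u′-collapse (punchIn p j)) (cong (lookup u) (collapse-punchIn j)))) (trans e nBlocks′))

  children-unique : Unique (children (b , u))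
  children-unique = Unique.++⁺ extensions-unique (Unique.map⁺ addSingleton-injective (Unique.allFin⁺ (suc n))) disjoint
    where
    extensions-unique : Unique (extensions (b , u))
    extensions-unique with lastIndex u (nBlocks b)
    ... | just _  = All.[] AllPairs.∷ AllPairs.[]
    ... | nothing = AllPairs.[]
    addSingleton-injective : ∀ {p p′} → addSingleton (b , u) p ≡ addSingleton (b , u) p′ → p ≡ p′
    addSingleton-injective {p} {p′} eq = IsLastIndex-unique (child-lastIndex (singletonChild p))
      (subst (λ y → IsLastIndex (proj₂ y) (nBlocks (proj₁ y)) p′) (sym eq) (child-lastIndex (singletonChild p′)))
    disjoint : ∀ {y} → ¬ (y ∈ extensions (b , u) × y ∈ map (addSingleton (b , u)) (allFin (suc n)))
    disjoint (y∈extensions , y∈singletons) with lastIndex u (nBlocks b)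
    disjoint (here refl , y∈singletons) | just c with ∈.∈-map⁻ (addSingleton (b , u)) {xs = allFin (suc n)} y∈singletons
    ... | p , _ , eq = ℕ.1+n≢n (trans (sym (AddSingleton.nBlocks′ b u valid p))
                         (trans (cong (nBlocks ∘ proj₁) (sym eq)) (ExtendBlock.nBlocks′ b u valid c)))

parent-unique : ∀ {n} {x x′ : NCMton n} {y} (child : ChildOf x y) (child′ : ChildOf x′ y) →
                insertionPoint child ≡ insertionPoint child′ → x ≡ x′
parent-unique {x′ = x′} child child′ same-point with child-insert child | child-insert child′
... | r , l , y= | r′ , l′ , y=′ =
  insert-injective (trans (sym y=) (trans y=′ (cong (λ p → insert x′ p r′ l′) (sym same-point))))

-- The insertion point of a child is the last position of its top label, so the child determines it.
children-disjoint : ∀ {n} {x x′ : NCMton n} {y} → IsNCMton n x → IsNCMton n x′ →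
                    y ∈ children x → y ∈ children x′ → x ≡ x′
children-disjoint {x = b , u} {b′ , u′} valid valid′ y∈ y∈′ = parent-unique (childOf y∈) (childOf y∈′)
  (IsLastIndex-unique (child-lastIndex b u valid (childOf y∈)) (child-lastIndex b′ u′ valid′ (childOf y∈′)))

unique-concatMap⁺ : ∀ {A B : Set} (f : A → List B) {xs : List A} → Unique xs → (∀ {x} → x ∈ xs → Unique (f x)) →
  (∀ {x x′ y} → x ∈ xs → x′ ∈ xs → y ∈ f x → y ∈ f x′ → x ≡ x′) → Unique (concatMap f xs)
unique-concatMap⁺ f {[]}     AllPairs.[]               _      _        = AllPairs.[]
unique-concatMap⁺ f {x ∷ xs} (x∉xs AllPairs.∷ unique) unique-f disjoint =
  Unique.++⁺ (unique-f (here refl))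
    (unique-concatMap⁺ f unique (unique-f ∘ there) (λ x∈ x′∈ → disjoint (there x∈) (there x′∈)))
    λ (y∈fx , y∈rest) → let (x′ , x′∈ , y∈fx′) = find (∈.∈-concatMap⁻ f {xs = xs} y∈rest) in
      All.lookup x∉xs x′∈ (disjoint (here refl) (there x′∈) y∈fx y∈fx′)

enum-sound : ∀ n {y} → y ∈ enum n → IsNCMton n y
enum-sound zero    (here refl) = (((λ ()) , (λ ())) , (λ ())) , ((λ ()) , (λ ()) , (λ ()) , (λ ()))
enum-sound (suc n) y∈ with find (∈.∈-concatMap⁻ children {xs = enum n} y∈)
... | (b , u) , x∈ , y∈children = child-valid b u (enum-sound n x∈) (childOf y∈children)

enum-unique : ∀ n → Unique (enum n)
enum-unique zero    = All.[] AllPairs.∷ AllPairs.[]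
enum-unique (suc n) = unique-concatMap⁺ children (enum-unique n)
  (λ {(b , u)} x∈ → children-unique b u (enum-sound n x∈))
  (λ x∈ x′∈ → children-disjoint (enum-sound n x∈) (enum-sound n x′∈))

enum-suc⁺ : ∀ {n} {x : NCMton n} {y} → x ∈ enum n → y ∈ children x → y ∈ enum (suc n)
enum-suc⁺ x∈ y∈ = ∈.∈-concatMap⁺ children (lose x∈ y∈)

addSingleton∈children : ∀ {n} (x : NCMton n) p → addSingleton x p ∈ children x
addSingleton∈children {n} x p = ∈.∈-++⁺ʳ (extensions x) (∈.∈-map⁺ (addSingleton x) (∈.∈-allFin p))

extendBlock∈children : ∀ {n} (x : NCMton n) c → IsLastIndex (proj₂ x) (nBlocks (proj₁ x)) c → extendBlock x c ∈ children x
extendBlock∈children x c c-last rewrite lastIndex-complete (proj₂ x) (nBlocks (proj₁ x)) c c-last = here refl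

enum-complete : ∀ n {y} → IsNCMton n y → y ∈ enum n
enum-complete zero    {Vec.[] , Vec.[]} _ = here refl
enum-complete (suc n) {b′ , u′} valid′ with topLabel-lastIndex b′ u′ valid′
... | c , c-last with lookup b′ c Fin.≟ c
...   | yes c-min with restrict-singleton b′ u′ valid′ c c-last c-min
...     | x-valid , y= = subst (_∈ enum (suc n)) (sym y=) (enum-suc⁺ (enum-complete n {x} x-valid) (addSingleton∈children x c))
  where
  x : NCMton n
  x = Restrict.b b′ u′ valid′ c c-last , Restrict.u b′ u′ valid′ c c-last
enum-complete (suc n) {b′ , u′} valid′ | Fin.zero , _ | no zero-not-min =
  ⊥-elim (zero-not-min (Fin.≤-antisym (Valid.rep≤ b′ u′ valid′ Fin.zero) z≤n))
enum-complete (suc n) {b′ , u′} valid′ | Fin.suc c₀ , c-last | no c-not-min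
  with restrict-extension b′ u′ valid′ c₀ c-last c-not-min
... | x-valid , c₀-last , y= =
  subst (_∈ enum (suc n)) (sym y=) (enum-suc⁺ (enum-complete n {x} x-valid) (extendBlock∈children x c₀ c₀-last))
  where
  x : NCMton n
  x = Restrict.b b′ u′ valid′ (Fin.suc c₀) c-last , Restrict.u b′ u′ valid′ (Fin.suc c₀) c-last

module _ {A : Set} where

  sum-map-++ : ∀ (h : A → ℕ) xs ys → sum (map h (xs ++ ys)) ≡ sum (map h xs) ℕ.+ sum (map h ys)
  sum-map-++ h xs ys = trans (cong sum (List.map-++ h xs ys)) (sum-++ (map h xs) (map h ys))

  sum-map-cong-∈ : ∀ (g h : A → ℕ) xs → (∀ {x} → x ∈ xs → g x ≡ h x) → sum (map g xs) ≡ sum (map h xs)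
  sum-map-cong-∈ g h []       _   = refl
  sum-map-cong-∈ g h (x ∷ xs) g=h = cong₂ ℕ._+_ (g=h (here refl)) (sum-map-cong-∈ g h xs (g=h ∘ there))

  sum-map-+ : ∀ (g h : A → ℕ) xs → sum (map (λ x → g x ℕ.+ h x) xs) ≡ sum (map g xs) ℕ.+ sum (map h xs)
  sum-map-+ g h []       = refl
  sum-map-+ g h (x ∷ xs) = trans (cong (g x ℕ.+ h x ℕ.+_) (sum-map-+ g h xs)) (interchange (g x) (h x) _ _)
    where
    interchange : ∀ a b c d → (a ℕ.+ b) ℕ.+ (c ℕ.+ d) ≡ (a ℕ.+ c) ℕ.+ (b ℕ.+ d)
    interchange = ℕ.solve-∀

  sum-map-*ˡ : ∀ N (h : A → ℕ) xs → sum (map (λ x → N ℕ.* h x) xs) ≡ N ℕ.* sum (map h xs)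
  sum-map-*ˡ N h []       = sym (ℕ.*-zeroʳ N)
  sum-map-*ˡ N h (x ∷ xs) = trans (cong (N ℕ.* h x ℕ.+_) (sum-map-*ˡ N h xs)) (sym (ℕ.*-distribˡ-+ N (h x) _))

  sum-map-const : ∀ c (xs : List A) → sum (map (const c) xs) ≡ length xs ℕ.* c
  sum-map-const c []       = refl
  sum-map-const c (x ∷ xs) = cong (c ℕ.+_) (sum-map-const c xs)

sum-map-concatMap : ∀ {A B : Set} (h : B → ℕ) (f : A → List B) xs →
                    sum (map h (concatMap f xs)) ≡ sum (map (λ x → sum (map h (f x))) xs)
sum-map-concatMap h f []       = refl
sum-map-concatMap h f (x ∷ xs) =
  trans (sum-map-++ h (f x) (concatMap f xs)) (cong (sum (map h (f x)) ℕ.+_) (sum-map-concatMap h f xs))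

blockCount : ∀ {n} → NCMton n → ℕ
blockCount (b , _) = nBlocks b

blockSum : (ℕ → ℕ) → ℕ → ℕ
blockSum g n = sum (map (g ∘ blockCount) (enum n))

blockSum-cong : ∀ {g h} n → (∀ m → g m ≡ h m) → blockSum g n ≡ blockSum h n
blockSum-cong {g} {h} n g=h = sum-map-cong-∈ (g ∘ blockCount) (h ∘ blockCount) (enum n) (λ {x} _ → g=h (blockCount x))

blockSum-+ : ∀ g h n → blockSum (λ m → g m ℕ.+ h m) n ≡ blockSum g n ℕ.+ blockSum h n
blockSum-+ g h n = sum-map-+ (g ∘ blockCount) (h ∘ blockCount) (enum n)

blockSum-*ˡ : ∀ N g n → blockSum (λ m → N ℕ.* g m) n ≡ N ℕ.* blockSum g n
blockSum-*ˡ N g n = sum-map-*ˡ N (g ∘ blockCount) (enum n)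

children-blockSum : ∀ {k} (b : Vec (Fin (suc k)) (suc k)) u → IsNCMton (suc k) (b , u) → ∀ g →
  sum (map (g ∘ blockCount) (children (b , u))) ≡ g (nBlocks b) ℕ.+ suc (suc k) ℕ.* g (suc (nBlocks b))
children-blockSum {k} b u valid g with topLabel-lastIndex b u valid
... | c , c-last = begin
  sum (map (g ∘ blockCount) (children x))
    ≡⟨ sum-map-++ (g ∘ blockCount) (extensions x) (map (addSingleton x) (allFin (suc (suc k)))) ⟩
  sum (map (g ∘ blockCount) (extensions x)) ℕ.+ sum (map (g ∘ blockCount) (map (addSingleton x) (allFin (suc (suc k)))))
    ≡⟨ cong₂ ℕ._+_ extension-sum singleton-sum ⟩
  g (nBlocks b) ℕ.+ suc (suc k) ℕ.* g (suc (nBlocks b)) ∎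
  where
  open ≡-Reasoning
  x : NCMton (suc k)
  x = (b , u)
  extension-sum : sum (map (g ∘ blockCount) (extensions x)) ≡ g (nBlocks b)
  extension-sum rewrite lastIndex-complete u (nBlocks b) c c-last =
    trans (ℕ.+-identityʳ _) (cong g (ExtendBlock.nBlocks′ b u valid c))
  singleton-sum : sum (map (g ∘ blockCount) (map (addSingleton x) (allFin (suc (suc k))))) ≡ suc (suc k) ℕ.* g (suc (nBlocks b))
  singleton-sum = begin
    sum (map (g ∘ blockCount) (map (addSingleton x) (allFin (suc (suc k)))))
      ≡⟨ cong sum (sym (List.map-∘ {g = g ∘ blockCount} {f = addSingleton x} (allFin (suc (suc k))))) ⟩
    sum (map (g ∘ blockCount ∘ addSingleton x) (allFin (suc (suc k))))
      ≡⟨ sum-map-cong-∈ (g ∘ blockCount ∘ addSingleton x) (const (g (suc (nBlocks b)))) (allFin (suc (suc k)))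
           (λ {p} _ → cong g (AddSingleton.nBlocks′ b u valid p)) ⟩
    sum (map (const (g (suc (nBlocks b)))) (allFin (suc (suc k))))
      ≡⟨ sum-map-const (g (suc (nBlocks b))) (allFin (suc (suc k))) ⟩
    length (allFin (suc (suc k))) ℕ.* g (suc (nBlocks b))
      ≡⟨ cong (ℕ._* g (suc (nBlocks b))) (List.length-tabulate {n = suc (suc k)} id) ⟩
    suc (suc k) ℕ.* g (suc (nBlocks b)) ∎

blockSum-suc : ∀ k g → blockSum g (suc (suc k)) ≡ blockSum g (suc k) ℕ.+ suc (suc k) ℕ.* blockSum (g ∘ suc) (suc k)
blockSum-suc k g = begin
  blockSum g (suc (suc k))
    ≡⟨ sum-map-concatMap (g ∘ blockCount) children (enum (suc k)) ⟩
  sum (map (λ x → sum (map (g ∘ blockCount) (children x))) (enum (suc k)))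
    ≡⟨ sum-map-cong-∈ _ _ (enum (suc k)) (λ {(b , u)} x∈ → children-blockSum b u (enum-sound (suc k) x∈) g) ⟩
  sum (map (λ x → g (blockCount x) ℕ.+ suc (suc k) ℕ.* g (suc (blockCount x))) (enum (suc k)))
    ≡⟨ blockSum-+ g (λ m → suc (suc k) ℕ.* g (suc m)) (suc k) ⟩
  blockSum g (suc k) ℕ.+ blockSum (λ m → suc (suc k) ℕ.* g (suc m)) (suc k)
    ≡⟨ cong (blockSum g (suc k) ℕ.+_) (blockSum-*ˡ (suc (suc k)) (g ∘ suc) (suc k)) ⟩
  blockSum g (suc k) ℕ.+ suc (suc k) ℕ.* blockSum (g ∘ suc) (suc k) ∎
  where open ≡-Reasoning

count blockSum₁ blockSum₂ : ℕ → ℕ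
count     = blockSum (const 1)
blockSum₁ = blockSum id
blockSum₂ = blockSum (λ m → m ℕ.* m)

count-suc : ∀ k → count (suc (suc k)) ≡ count (suc k) ℕ.+ suc (suc k) ℕ.* count (suc k)
count-suc k = blockSum-suc k (const 1)

blockSum₁-suc : ∀ k → blockSum₁ (suc (suc k))
                      ≡ blockSum₁ (suc k) ℕ.+ suc (suc k) ℕ.* (blockSum₁ (suc k) ℕ.+ count (suc k))
blockSum₁-suc k = trans (blockSum-suc k id)
  (cong (λ s → blockSum₁ (suc k) ℕ.+ suc (suc k) ℕ.* s)
    (trans (blockSum-cong (suc k) (λ m → ℕ.+-comm 1 m)) (blockSum-+ id (const 1) (suc k))))

blockSum₂-suc : ∀ k → blockSum₂ (suc (suc k))
                      ≡ blockSum₂ (suc k) ℕ.+ suc (suc k) ℕ.* (blockSum₂ (suc k) ℕ.+ 2 ℕ.* blockSum₁ (suc k) ℕ.+ count (suc k))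
blockSum₂-suc k = trans (blockSum-suc k (λ m → m ℕ.* m))
  (cong (λ s → blockSum₂ (suc k) ℕ.+ suc (suc k) ℕ.* s) (begin
    blockSum (λ m → suc m ℕ.* suc m) (suc k)
      ≡⟨ blockSum-cong (suc k) square-suc ⟩
    blockSum (λ m → (m ℕ.* m ℕ.+ 2 ℕ.* m) ℕ.+ 1) (suc k)
      ≡⟨ blockSum-+ (λ m → m ℕ.* m ℕ.+ 2 ℕ.* m) (const 1) (suc k) ⟩
    blockSum (λ m → m ℕ.* m ℕ.+ 2 ℕ.* m) (suc k) ℕ.+ count (suc k)
      ≡⟨ cong (ℕ._+ count (suc k)) (blockSum-+ (λ m → m ℕ.* m) (λ m → 2 ℕ.* m) (suc k)) ⟩
    (blockSum₂ (suc k) ℕ.+ blockSum (λ m → 2 ℕ.* m) (suc k)) ℕ.+ count (suc k)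
      ≡⟨ cong (λ s → (blockSum₂ (suc k) ℕ.+ s) ℕ.+ count (suc k)) (blockSum-*ˡ 2 id (suc k)) ⟩
    blockSum₂ (suc k) ℕ.+ 2 ℕ.* blockSum₁ (suc k) ℕ.+ count (suc k) ∎))
  where
  open ≡-Reasoning
  square-suc : ∀ m → suc m ℕ.* suc m ≡ (m ℕ.* m ℕ.+ 2 ℕ.* m) ℕ.+ 1
  square-suc = ℕ.solve-∀

ℚ-ring : ACR.AlmostCommutativeRing 0ℓ 0ℓ
ℚ-ring = ACR.fromCommutativeRing ℚ.+-*-commutativeRing (λ x → dec⇒maybe (0ℚ ℚ.≟ x))

-- Identities that only hold when w = 1 are reduced to ring identities up to a multiple of w − 1.
≡-by-unit : ∀ {lhs rhs w : ℚ} → w ≡ 1ℚ → (d : ℚ) → lhs ≡ rhs + d * (w - 1ℚ) → lhs ≡ rhs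
≡-by-unit {rhs = rhs} refl d eq = trans eq (solve (rhs ∷ d ∷ []) ℚ-ring)

≡-by-equal : ∀ {lhs rhs a b c : ℚ} → a ≡ c → b ≡ c → lhs ≡ rhs + (a - b) → lhs ≡ rhs
≡-by-equal {rhs = rhs} {c = c} refl refl eq = trans eq (solve (rhs ∷ c ∷ []) ℚ-ring)

fromℕ-suc : ∀ k → fromℕ (suc k) ≡ 1ℚ + fromℕ k
fromℕ-suc k = ℚ.toℚᵘ-injective (begin
  ℚ.toℚᵘ (fromℕ (suc k))                       ≈⟨ ℚ.toℚᵘ-fromℚᵘ (mkℚᵘ (+ suc k) 0) ⟩
  mkℚᵘ (+ suc k) 0                             ≈⟨ *≡* (ℤ-identity (+ k)) ⟩
  mkℚᵘ (+ 1) 0 ℚᵘ.+ mkℚᵘ (+ k) 0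
    ≈⟨ ℚᵘ.+-congʳ (mkℚᵘ (+ 1) 0) (ℚ.toℚᵘ-fromℚᵘ (mkℚᵘ (+ k) 0)) ⟨
  mkℚᵘ (+ 1) 0 ℚᵘ.+ ℚ.toℚᵘ (fromℕ k)           ≈⟨ ℚ.toℚᵘ-homo-+ 1ℚ (fromℕ k) ⟨
  ℚ.toℚᵘ (1ℚ + fromℕ k)                        ∎)
  where
  open ℚᵘ.≃-Reasoning
  ℤ-identity : ∀ (x : ℤ) → (+ 1 ℤ.+ x) ℤ.* + 1 ≡ (+ 1 ℤ.* + 1 ℤ.+ x ℤ.* + 1) ℤ.* + 1
  ℤ-identity = ℤ.solve-∀

fromℕ*inv : ∀ k → fromℕ (suc k) * inv (suc k) ≡ 1ℚ
fromℕ*inv k = ℚ.toℚᵘ-injective (begin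
  ℚ.toℚᵘ (fromℕ (suc k) * inv (suc k))              ≈⟨ ℚ.toℚᵘ-homo-* (fromℕ (suc k)) (inv (suc k)) ⟩
  ℚ.toℚᵘ (fromℕ (suc k)) ℚᵘ.* ℚ.toℚᵘ (inv (suc k))
    ≈⟨ ℚᵘ.*-cong (ℚ.toℚᵘ-fromℚᵘ (mkℚᵘ (+ suc k) 0)) (ℚ.toℚᵘ-fromℚᵘ (mkℚᵘ (+ 1) k)) ⟩
  mkℚᵘ (+ suc k) 0 ℚᵘ.* mkℚᵘ (+ 1) k
    ≈⟨ *≡* (trans (ℤ-identity (+ suc k)) (cong (λ m → + 1 ℤ.* + suc m) (sym (ℕ.+-identityʳ k)))) ⟩
  ℚ.toℚᵘ 1ℚ                                          ∎)
  where
  open ℚᵘ.≃-Reasoning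
  ℤ-identity : ∀ (x : ℤ) → (x ℤ.* + 1) ℤ.* + 1 ≡ + 1 ℤ.* x
  ℤ-identity = ℤ.solve-∀

fromℕ-+ : ∀ a b → fromℕ (a ℕ.+ b) ≡ fromℕ a + fromℕ b
fromℕ-+ zero    b = sym (ℚ.+-identityˡ (fromℕ b))
fromℕ-+ (suc a) b = begin
  fromℕ (suc (a ℕ.+ b))      ≡⟨ fromℕ-suc (a ℕ.+ b) ⟩
  1ℚ + fromℕ (a ℕ.+ b)       ≡⟨ cong (λ q → 1ℚ + q) (fromℕ-+ a b) ⟩
  1ℚ + (fromℕ a + fromℕ b)   ≡⟨ ℚ.+-assoc 1ℚ (fromℕ a) (fromℕ b) ⟨
  (1ℚ + fromℕ a) + fromℕ b   ≡⟨ cong (_+ fromℕ b) (fromℕ-suc a) ⟨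
  fromℕ (suc a) + fromℕ b    ∎
  where open ≡-Reasoning

fromℕ-* : ∀ a b → fromℕ (a ℕ.* b) ≡ fromℕ a * fromℕ b
fromℕ-* zero    b = sym (ℚ.*-zeroˡ (fromℕ b))
fromℕ-* (suc a) b = begin
  fromℕ (b ℕ.+ a ℕ.* b)          ≡⟨ fromℕ-+ b (a ℕ.* b) ⟩
  fromℕ b + fromℕ (a ℕ.* b)      ≡⟨ cong (λ q → fromℕ b + q) (fromℕ-* a b) ⟩
  fromℕ b + fromℕ a * fromℕ b    ≡⟨ cong (_+ fromℕ a * fromℕ b) (ℚ.*-identityˡ (fromℕ b)) ⟨
  1ℚ * fromℕ b + fromℕ a * fromℕ b ≡⟨ ℚ.*-distribʳ-+ (fromℕ b) 1ℚ (fromℕ a) ⟨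
  (1ℚ + fromℕ a) * fromℕ b       ≡⟨ cong (_* fromℕ b) (fromℕ-suc a) ⟨
  fromℕ (suc a) * fromℕ b        ∎
  where open ≡-Reasoning

inverse-unique : ∀ {x y z} → x * y ≡ 1ℚ → x * z ≡ 1ℚ → y ≡ z
inverse-unique {x} {y} {z} xy≡1 xz≡1 = begin
  y              ≡⟨ ℚ.*-identityʳ y ⟨
  y * 1ℚ         ≡⟨ cong (y *_) xz≡1 ⟨
  y * (x * z)    ≡⟨ solve (x ∷ y ∷ z ∷ []) ℚ-ring ⟩
  (x * y) * z    ≡⟨ cong (_* z) xy≡1 ⟩
  1ℚ * z         ≡⟨ ℚ.*-identityˡ z ⟩
  z              ∎
  where open ≡-Reasoning

inv-* : ∀ a b → inv (suc a ℕ.* suc b) ≡ inv (suc a) * inv (suc b)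
inv-* a b = inverse-unique {x = fromℕ (suc a ℕ.* suc b)} (fromℕ*inv (b ℕ.+ a ℕ.* suc b)) (begin
  fromℕ (suc a ℕ.* suc b) * (inv (suc a) * inv (suc b))
    ≡⟨ cong (_* (inv (suc a) * inv (suc b))) (fromℕ-* (suc a) (suc b)) ⟩
  (fromℕ (suc a) * fromℕ (suc b)) * (inv (suc a) * inv (suc b))
    ≡⟨ interchange (fromℕ (suc a)) (fromℕ (suc b)) (inv (suc a)) (inv (suc b)) ⟩
  (fromℕ (suc a) * inv (suc a)) * (fromℕ (suc b) * inv (suc b))
    ≡⟨ cong₂ _*_ (fromℕ*inv a) (fromℕ*inv b) ⟩
  1ℚ ∎)
  where
  open ≡-Reasoning
  interchange : ∀ p q r s → (p * q) * (r * s) ≡ (p * r) * (q * s)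
  interchange = solve-∀ ℚ-ring

inv-4-square : ∀ m → inv (4 ℕ.* (suc m ℕ.* suc m)) ≡ inv 4 * (inv (suc m) * inv (suc m))
inv-4-square m = trans (inv-* 3 (m ℕ.+ m ℕ.* suc m)) (cong (inv 4 *_) (inv-* m m))

*-fromℕ-inv : ∀ x {m} → 1 ℕ.≤ m → (x * fromℕ m) * inv m ≡ x
*-fromℕ-inv x {suc m} _ = trans (ℚ.*-assoc x _ _) (trans (cong (x *_) (fromℕ*inv m)) (ℚ.*-identityʳ x))

mean : ℕ → ℚ
mean n = ((fromℕ n - H n) + (+ 3 / 2)) - inv (suc n)

variance : ℕ → ℚ
variance n = (H n - H2 n) - ((fromℕ (n ∸ 1) * fromℕ (n ∸ 1)) * inv (4 ℕ.* (suc n ℕ.* suc n)))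

secondMoment : ℕ → ℚ
secondMoment n = variance n + mean n * mean n

mean-suc : ∀ k → mean (suc (suc k)) ≡ (mean (suc k) + 1ℚ) - inv (suc (suc (suc k)))
mean-suc k = begin
  mean (suc (suc k))                   ≡⟨ cong (λ q → ((q - (h + i₂)) + t) - i₃) (fromℕ-suc (suc k)) ⟩
  (((1ℚ + y′) - (h + i₂)) + t) - i₃    ≡⟨ shift y′ h t i₂ i₃ ⟩
  (mean (suc k) + 1ℚ) - i₃             ∎
  where
  open ≡-Reasoning
  h y′ t i₂ i₃ : ℚ
  h = H (suc k)
  y′ = fromℕ (suc k)
  t = + 3 / 2
  i₂ = inv (suc (suc k))
  i₃ = inv (suc (suc (suc k)))
  shift : ∀ y h t i j → (((1ℚ + y) - (h + i)) + t) - j ≡ ((((y - h) + t) - i) + 1ℚ) - j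
  shift = solve-∀ ℚ-ring

-- Expanding ((2 + x) i)² / 4 shows that the left-hand side is 1/4 as soon as (2 + x) i = 1.
quarter : ∀ x i → (1ℚ + (1ℚ + x)) * i ≡ 1ℚ → (i - i * i) + (x * x) * (inv 4 * (i * i)) ≡ inv 4
quarter x i w≡1 = ≡-by-unit w≡1 (inv 4 * ((1ℚ + (1ℚ + x)) * i + 1ℚ) - i) (solve (x ∷ i ∷ []) ℚ-ring)

fromℕ-2+ : ∀ k → fromℕ (suc (suc k)) ≡ 1ℚ + (1ℚ + fromℕ k)
fromℕ-2+ k = trans (fromℕ-suc (suc k)) (cong (λ q → 1ℚ + q) (fromℕ-suc k))

variance-suc : ∀ k → let i = inv (suc (suc (suc k))) in variance (suc (suc k)) ≡ variance (suc k) + (i - i * i)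
variance-suc k = begin
  variance (suc (suc k))
    ≡⟨ cong₂ (λ s t → ((h + i₂) - (h₂ + s)) - (y′ * y′) * t) (inv-* (suc k) (suc k)) (inv-4-square (suc (suc k))) ⟩
  ((h + i₂) - (h₂ + i₂ * i₂)) - (y′ * y′) * (inv 4 * (i₃ * i₃))
    ≡⟨ ≡-by-equal (quarter y i₂ (trans (cong (_* i₂) (sym (fromℕ-2+ k))) (fromℕ*inv (suc k))))
                  (quarter y′ i₃ (trans (cong (_* i₃) (sym (fromℕ-2+ (suc k)))) (fromℕ*inv (suc (suc k)))))
                  (step h h₂ y y′ i₂ i₃) ⟩
  ((h - h₂) - (y * y) * (inv 4 * (i₂ * i₂))) + (i₃ - i₃ * i₃)
    ≡⟨ cong (λ t → ((h - h₂) - (y * y) * t) + (i₃ - i₃ * i₃)) (inv-4-square (suc k)) ⟨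
  variance (suc k) + (i₃ - i₃ * i₃) ∎
  where
  open ≡-Reasoning
  h h₂ y y′ i₂ i₃ : ℚ
  h = H (suc k)
  h₂ = H2 (suc k)
  y = fromℕ k
  y′ = fromℕ (suc k)
  i₂ = inv (suc (suc k))
  i₃ = inv (suc (suc (suc k)))
  step : ∀ h h₂ y y′ i₂ i₃ →
    ((h + i₂) - (h₂ + i₂ * i₂)) - (y′ * y′) * (inv 4 * (i₃ * i₃))
    ≡ (((h - h₂) - (y * y) * (inv 4 * (i₂ * i₂))) + (i₃ - i₃ * i₃))
      + (((i₂ - i₂ * i₂) + (y * y) * (inv 4 * (i₂ * i₂))) - ((i₃ - i₃ * i₃) + (y′ * y′) * (inv 4 * (i₃ * i₃))))
  step = solve-∀ ℚ-ring

mean-step : ∀ e a M i → (1ℚ + M) * i ≡ 1ℚ → e * a + M * (e * a + a) ≡ ((e + 1ℚ) - i) * (a + M * a)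
mean-step e a M i w≡1 = ≡-by-unit w≡1 a (solve (e ∷ a ∷ M ∷ i ∷ []) ℚ-ring)

secondMoment-step : ∀ v e a M i → (1ℚ + M) * i ≡ 1ℚ →
  (v + e * e) * a + M * (((v + e * e) * a + (1ℚ + 1ℚ) * (e * a)) + a)
  ≡ ((v + (i - i * i)) + ((e + 1ℚ) - i) * ((e + 1ℚ) - i)) * (a + M * a)
secondMoment-step v e a M i w≡1 = ≡-by-unit w≡1 (a * ((1ℚ + 1ℚ) * e + 1ℚ)) (solve (v ∷ e ∷ a ∷ M ∷ i ∷ []) ℚ-ring)

count-positive : ∀ k → 1 ℕ.≤ count (suc k)
count-positive zero    = ℕ.≤-refl
count-positive (suc k) = subst (1 ℕ.≤_) (sym (count-suc k)) (ℕ.≤-trans (count-positive k) (ℕ.m≤m+n _ _))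

moments : ∀ k → fromℕ (blockSum₁ (suc k)) ≡ mean (suc k) * fromℕ (count (suc k))
              × fromℕ (blockSum₂ (suc k)) ≡ secondMoment (suc k) * fromℕ (count (suc k))
moments zero    = refl , refl
moments (suc k) = blockSum₁-eq , blockSum₂-eq
  where
  open ≡-Reasoning
  c₀ c₁ c₂ : ℕ
  c₀ = count (suc k)
  c₁ = blockSum₁ (suc k)
  c₂ = blockSum₂ (suc k)
  e v a f s M i : ℚ
  e = mean (suc k)
  v = variance (suc k)
  a = fromℕ c₀
  f = fromℕ c₁
  s = fromℕ c₂
  M = fromℕ (suc (suc k))
  i = inv (suc (suc (suc k)))
  unit : (1ℚ + M) * i ≡ 1ℚ
  unit = trans (cong (_* i) (sym (fromℕ-suc (suc (suc k))))) (fromℕ*inv (suc (suc k)))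
  fromℕ-step : ∀ x y → fromℕ (x ℕ.+ suc (suc k) ℕ.* y) ≡ fromℕ x + M * fromℕ y
  fromℕ-step x y = trans (fromℕ-+ x _) (cong (λ q → fromℕ x + q) (fromℕ-* (suc (suc k)) y))
  count-eq : fromℕ (count (suc (suc k))) ≡ a + M * a
  count-eq = trans (cong fromℕ (count-suc k)) (fromℕ-step c₀ c₀)
  blockSum₁-eq : fromℕ (blockSum₁ (suc (suc k))) ≡ mean (suc (suc k)) * fromℕ (count (suc (suc k)))
  blockSum₁-eq = begin
    fromℕ (blockSum₁ (suc (suc k)))                 ≡⟨ cong fromℕ (blockSum₁-suc k) ⟩
    fromℕ (c₁ ℕ.+ suc (suc k) ℕ.* (c₁ ℕ.+ c₀))      ≡⟨ fromℕ-step c₁ (c₁ ℕ.+ c₀) ⟩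
    f + M * fromℕ (c₁ ℕ.+ c₀)                       ≡⟨ cong (λ q → f + M * q) (fromℕ-+ c₁ c₀) ⟩
    f + M * (f + a)                                 ≡⟨ cong (λ q → q + M * (q + a)) (proj₁ (moments k)) ⟩
    e * a + M * (e * a + a)                         ≡⟨ mean-step e a M i unit ⟩
    ((e + 1ℚ) - i) * (a + M * a)                    ≡⟨ cong₂ _*_ (mean-suc k) count-eq ⟨
    mean (suc (suc k)) * fromℕ (count (suc (suc k))) ∎
  blockSum₂-eq : fromℕ (blockSum₂ (suc (suc k))) ≡ secondMoment (suc (suc k)) * fromℕ (count (suc (suc k)))
  blockSum₂-eq = begin
    fromℕ (blockSum₂ (suc (suc k)))
      ≡⟨ cong fromℕ (blockSum₂-suc k) ⟩
    fromℕ (c₂ ℕ.+ suc (suc k) ℕ.* (c₂ ℕ.+ 2 ℕ.* c₁ ℕ.+ c₀))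
      ≡⟨ fromℕ-step c₂ (c₂ ℕ.+ 2 ℕ.* c₁ ℕ.+ c₀) ⟩
    s + M * fromℕ (c₂ ℕ.+ 2 ℕ.* c₁ ℕ.+ c₀)
      ≡⟨ cong (λ q → s + M * q) (trans (fromℕ-+ (c₂ ℕ.+ 2 ℕ.* c₁) c₀)
           (cong (_+ a) (trans (fromℕ-+ c₂ (2 ℕ.* c₁)) (cong (λ q → s + q) (fromℕ-* 2 c₁))))) ⟩
    s + M * ((s + (1ℚ + 1ℚ) * f) + a)
      ≡⟨ cong₂ (λ q r → q + M * ((q + (1ℚ + 1ℚ) * r) + a)) (proj₂ (moments k)) (proj₁ (moments k)) ⟩
    (v + e * e) * a + M * (((v + e * e) * a + (1ℚ + 1ℚ) * (e * a)) + a)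
      ≡⟨ secondMoment-step v e a M i unit ⟩
    ((v + (i - i * i)) + ((e + 1ℚ) - i) * ((e + 1ℚ) - i)) * (a + M * a)
      ≡⟨ cong₂ _*_ (cong₂ (λ q r → q + r * r) (variance-suc k) (mean-suc k)) count-eq ⟨
    secondMoment (suc (suc k)) * fromℕ (count (suc (suc k))) ∎

sumℚ-↭ : ∀ {A : Set} (f : A → ℚ) {xs ys : List A} → xs ↭ ys → sumℚ (map f xs) ≡ sumℚ (map f ys)
sumℚ-↭ f ↭.refl            = refl
sumℚ-↭ f (↭.prep x p)      = cong (λ s → f x + s) (sumℚ-↭ f p)
sumℚ-↭ f (↭.swap x y p)    = trans (cong (λ s → f x + (f y + s)) (sumℚ-↭ f p)) (swap (f x) (f y) _)
  where
  swap : ∀ a b c → a + (b + c) ≡ b + (a + c)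
  swap = solve-∀ ℚ-ring
sumℚ-↭ f (↭.trans p q)     = trans (sumℚ-↭ f p) (sumℚ-↭ f q)

sumℚ-map-cong : ∀ {A : Set} (f g : A → ℚ) xs → (∀ x → f x ≡ g x) → sumℚ (map f xs) ≡ sumℚ (map g xs)
sumℚ-map-cong f g []       f=g = refl
sumℚ-map-cong f g (x ∷ xs) f=g = cong₂ _+_ (f=g x) (sumℚ-map-cong f g xs f=g)

sumℚ-map-fromℕ : ∀ {A : Set} (h : A → ℕ) xs → sumℚ (map (fromℕ ∘ h) xs) ≡ fromℕ (sum (map h xs))
sumℚ-map-fromℕ h []       = refl
sumℚ-map-fromℕ h (x ∷ xs) =
  trans (cong (λ s → fromℕ (h x) + s) (sumℚ-map-fromℕ h xs)) (sym (fromℕ-+ (h x) (sum (map h xs))))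

expectation : ∀ {k} {L : List (NCMton (suc k))} → L ↭ enum (suc k) → ∀ f g {x} →
  (∀ y → f y ≡ fromℕ (g (blockCount y))) → fromℕ (blockSum g (suc k)) ≡ x * fromℕ (count (suc k)) → E L f ≡ x
expectation {k} {L} L↭enum f g {x} f=g sum≡x*count = begin
  sumℚ (map f L) * inv (length L)                    ≡⟨ cong₂ (λ s l → s * inv l) sum-eq length-eq ⟩
  fromℕ (blockSum g (suc k)) * inv (count (suc k))   ≡⟨ cong (_* inv (count (suc k))) sum≡x*count ⟩
  (x * fromℕ (count (suc k))) * inv (count (suc k))  ≡⟨ *-fromℕ-inv x (count-positive k) ⟩
  x                                                  ∎
  where
  open ≡-Reasoning
  sum-eq : sumℚ (map f L) ≡ fromℕ (blockSum g (suc k))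
  sum-eq = trans (sumℚ-↭ f L↭enum) (trans (sumℚ-map-cong f (fromℕ ∘ g ∘ blockCount) (enum (suc k)) f=g)
                                           (sumℚ-map-fromℕ (g ∘ blockCount) (enum (suc k))))
  length-eq : length L ≡ count (suc k)
  length-eq = trans (↭-length L↭enum) (sym (trans (sum-map-const 1 (enum (suc k))) (ℕ.*-identityʳ _)))

-- The formulas hold for every n ≥ 1; the hypothesis 2 ≤ n only excludes n = 0.
theorem1p6 : (n : ℕ) → 2 ≤ n →
  (L : List (NCMton n)) → Unique L → (∀ x → (x ∈ L) ⇔ IsNCMton n x) →
  (E L Y ≡ ((fromℕ n - H n) + (+ 3 / 2)) - inv (ℕ.suc n))
  × (Var L Y ≡ (H n - H2 n) - ((fromℕ (n ∸ 1) * fromℕ (n ∸ 1)) * inv (4 ℕ.* (ℕ.suc n ℕ.* ℕ.suc n))))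
theorem1p6 (suc k) (s≤s _) L unique L⇔NCMton = E-Y , Var-Y
  where
  L↭enum : L ↭ enum (suc k)
  L↭enum = ∼bag⇒↭ (unique∧set⇒bag unique (enum-unique (suc k)) λ {y} →
    mk⇔ (enum-complete (suc k) ∘ Equivalence.to (L⇔NCMton y))
        (Equivalence.from (L⇔NCMton y) ∘ enum-sound (suc k)))
  E-Y : E L Y ≡ mean (suc k)
  E-Y = expectation L↭enum Y id (λ _ → refl) (proj₁ (moments k))
  E-Y² : E L (λ y → Y y * Y y) ≡ secondMoment (suc k)
  E-Y² = expectation L↭enum (λ y → Y y * Y y) (λ m → m ℕ.* m)
           (λ y → sym (fromℕ-* (blockCount y) (blockCount y))) (proj₂ (moments k))
  Var-Y : Var L Y ≡ variance (suc k)
  Var-Y = trans (cong₂ (λ s e → s - e * e) E-Y² E-Y) (cancel (variance (suc k)) (mean (suc k)))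
    where
    cancel : ∀ v e → (v + e * e) - e * e ≡ v
    cancel = solve-∀ ℚ-ring
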